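{- A complete history $c$ (in which each value is enqueued at most once) is linearizable with respect to the queue specification if and only if it has none of the violations $\mathsf{VFresh}$, $\mathsf{VRepet}$, $\mathsf{VOrd}$, $\mathsf{VWit}$.
   Context: A queue event is a tuple $(u,m,d_{in},d_{out})$ with unique identifier $u$, $m\in\{\mathtt{enq},\mathtt{deq}\}$; $\mathtt{enq}(x)$ denotes an enqueue of $x\in\mathbb{N}$ and $\mathtt{deq}(x)$ a dequeue returning $x\in\mathbb{N}\cup\{\mathtt{NULL}\}$. Each event $a$ has invocation $\mathit{inv}(a)$ and response $\mathit{res}(a)$; a history is a finite sequence of such actions, each at most once, responses after invocations; complete if every invoked event responded. $e\prec_c e'$ iff $\mathit{res}(e)$ occurs before $\mathit{inv}(e')$ in $c$. $\mathrm{Enq}(c)$, $\mathrm{Deq}(c)$ are the enqueue/dequeue events, $\mathrm{Val}(c,e)$ the value enqueued or returned. Each value is assumed enqueued at most once, so $\mathtt{enq}(x)$ names a unique event. Violations of complete $c$: ($\mathsf{VFresh}$) some $x\neq\mathtt{NULL}$ has $\mathtt{deq}(x)\in\mathrm{Deq}(c)$ and either $\mathtt{enq}(x)\notin\mathrm{Enq}(c)$ or $\mathtt{deq}(x)\prec_c\mathtt{enq}(x)$; ($\mathsf{VRepet}$) there are distinct $d,d'\in\mathrm{Deq}(c)$ with $\mathrm{Val}(c,d)=\mathrm{Val}(c,d')\neq\mathtt{NULL}$; ($\mathsf{VOrd}$) there are values $x,y$ with $\mathtt{enq}(y)\prec_c\mathtt{enq}(x)$, $\mathtt{deq}(x)\in\mathrm{Deq}(c)$,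 and either no dequeue of $y$ is in $\mathrm{Deq}(c)$ or $\mathtt{deq}(x)\prec_c\mathtt{deq}(y)$; ($\mathsf{VWit}$) there is a dequeue event $d$ returning $\mathtt{NULL}$, writing $c=c_0\cdot\mathit{inv}(d)\cdot c_d\cdot\mathit{res}(d)\cdot c_3$, such that for every split $c_d=c_1\cdot c_2$ there exists an enqueue event $\mathtt{enq}(x)$ completed in $c_0\cdot\mathit{inv}(d)\cdot c_1$ such that the invocation of a dequeue returning $x$ does not occur in $c_0\cdot\mathit{inv}(d)\cdot c_1$. Linearizability: a behavior (sequence of events) is legal if it labels a run from $\varepsilon$ of $\mathsf{LTS}_Q$ (states: finite sequences over $\mathbb{N}$; $q\xrightarrow{\mathtt{enq}(x)}q\cdot x$, $x\cdot q'\xrightarrow{\mathtt{deq}(x)}q'$, $\varepsilon\xrightarrow{\mathtt{deq}(\mathtt{NULL})}\varepsilon$); a complete history $c$ is linearizable w.r.t. the queue if there is a legal ordering $s$ of the events of $c$ such that $e\prec_c e'$ implies $e$ precedes $e'$ in $s$. -}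

module Defs where

open import Data.Nat using (ℕ)
open import Data.Maybe using (Maybe; just; nothing)
open import Data.List using (List; []; _∷_; _++_)
open import Data.List.Membership.Propositional using (_∈_; _∉_)
open import Data.List.Relation.Unary.Unique.Propositional using (Unique)
open import Data.Product using (Σ; ∃; ∃-syntax; _×_; _,_)
open import Data.Sum using (_⊎_)
open import Relation.Binary.PropositionalEquality using (_≡_; _≢_)
open import Relation.Nullary using (¬_)
open import Function.Bundles using (_⇔_)

-- Method together with its data: enq(x) (input x) or deq(r) where the
-- output r is `just x` for a value x or `nothing` for NULL.
data Op : Set where
  enq : ℕ → Op
  deq : Maybe ℕ → Op

-- A queue event (u, m, d_in, d_out) with unique identifier u.
record Event : Set where
  constructor mkEv
  field
    uid : ℕ
    op  : Op
open Event public

data Action : Set where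
  inv : Event → Action
  res : Event → Action

History : Set
History = List Action

EvOf : History → Event → Set
EvOf c e = inv e ∈ c

WellFormed : History → Set
WellFormed c =
  Unique c
  × (∀ e → res e ∈ c → ∃[ p ] ∃[ s ] (c ≡ p ++ res e ∷ s × inv e ∈ p))
  × (∀ e e' → EvOf c e → EvOf c e' → uid e ≡ uid e' → e ≡ e')

Complete : History → Set
Complete c = ∀ e → inv e ∈ c → res e ∈ c

_≺[_]_ : Event → History → Event → Set
e ≺[ c ] e' = ∃[ p ] ∃[ s ] (c ≡ p ++ res e ∷ s × inv e' ∈ s)

IsEnqOf : History → Event → ℕ → Set
IsEnqOf c e x = EvOf c e × op e ≡ enq x

IsDeqOf : History → Event → Maybe ℕ → Set
IsDeqOf c e r = EvOf c e × op e ≡ deq r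

EnqUnique : History → Set
EnqUnique c = ∀ e e' x → IsEnqOf c e x → IsEnqOf c e' x → e ≡ e'

VFresh : History → Set
VFresh c = ∃[ x ] ∃[ d ] (IsDeqOf c d (just x) ×
  ((¬ (∃[ e ] IsEnqOf c e x)) ⊎ (∃[ e ] (IsEnqOf c e x × d ≺[ c ] e))))

VRepet : History → Set
VRepet c = ∃[ x ] ∃[ d ] ∃[ d' ] (d ≢ d' × IsDeqOf c d (just x) × IsDeqOf c d' (just x))

VOrd : History → Set
VOrd c = ∃[ x ] ∃[ y ] ∃[ ex ] ∃[ ey ] ∃[ dx ]
  (IsEnqOf c ex x × IsEnqOf c ey y × ey ≺[ c ] ex × IsDeqOf c dx (just x) ×
   ((¬ (∃[ dy ] IsDeqOf c dy (just y))) ⊎ (∃[ dy ] (IsDeqOf c dy (just y) × dx ≺[ c ] dy))))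

VWit : History → Set
VWit c = ∃[ d ] ∃[ c₀ ] ∃[ cd ] ∃[ c₃ ]
  (IsDeqOf c d nothing × c ≡ c₀ ++ inv d ∷ cd ++ res d ∷ c₃ ×
   (∀ c₁ c₂ → cd ≡ c₁ ++ c₂ →
     ∃[ x ] ∃[ e ] (IsEnqOf c e x × res e ∈ (c₀ ++ inv d ∷ c₁) ×
       ¬ (∃[ d' ] (IsDeqOf c d' (just x) × inv d' ∈ (c₀ ++ inv d ∷ c₁))))))

HasViolation : History → Set
HasViolation c = VFresh c ⊎ VRepet c ⊎ VOrd c ⊎ VWit c

data Run : List ℕ → List Event → Set where
  done  : ∀ {q} → Run q []
  stEnq : ∀ {q s u x} → Run (q ++ x ∷ []) s → Run q (mkEv u (enq x) ∷ s)
  stDeq : ∀ {q s u x} → Run q s → Run (x ∷ q) (mkEv u (deq (just x)) ∷ s)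
  stNul : ∀ {s u} → Run [] s → Run [] (mkEv u (deq nothing) ∷ s)

Legal : List Event → Set
Legal s = Run [] s

Precedes : List Event → Event → Event → Set
Precedes s e e' = ∃[ p ] ∃[ r ] (s ≡ p ++ e ∷ r × e' ∈ r)

OrderingOf : History → List Event → Set
OrderingOf c s = Unique s × (∀ e → e ∈ s ⇔ EvOf c e)

Linearizable : History → Set
Linearizable c = ∃[ s ] (OrderingOf c s × Legal s ×
  (∀ e e' → e ≺[ c ] e' → Precedes s e e'))

-- A linearization s of c is a legal run of the sequential queue, so the queue content before any
-- event of s is the values enqueued so far minus those dequeued, in FIFO order. Each violation
-- contradicts this at the offending dequeue; for VWit one cuts c right after the latest invocation
-- among the null dequeue and the events linearized before it.
--
-- Conversely, let I e and R e be the positions of the invocation and response of e in c. For a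
-- null dequeue n, the absence of VWit yields a time T n between I n and R n by which every
-- completed enqueue has had its dequeue invoked. A linearization is built greedily: with f the
-- pending event responding first, one linearizes a pending null dequeue (on an empty queue) or a
-- dequeue of the head invoked before f responds; otherwise an enqueue chosen so that dequeues can
-- follow in FIFO order. The absence of VFresh, VRepet and VOrd, restated relative to the current
-- queue content, is an invariant of this process.

module Submission where

open import Defs
open import Data.Empty using (⊥; ⊥-elim)
open import Data.Unit using (⊤; tt)
open import Data.Nat using (ℕ; zero; suc; _+_; _∸_; _≤_; _<_; _≤?_; _<?_; z≤n; s≤s; s≤s⁻¹) renaming (_≟_ to _≟ℕ_)
open import Data.Nat.Properties
open import Data.Maybe using (just; nothing)
open import Data.Maybe.Properties using (≡-dec)
open import Data.Product using (∃-syntax; _×_; _,_; proj₁; proj₂)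
open import Data.Sum using (_⊎_; inj₁; inj₂; [_,_])
open import Data.List using (List; []; _∷_; _++_; length; filter)
open import Data.List.Properties using (++-assoc; ++-identityʳ; ++-conicalʳ; ∷-injective; length-++; filter-notAll)
open import Data.List.Membership.Propositional using (_∈_; _∉_; find; lose)
open import Data.List.Membership.Propositional.Properties using (∈-++⁻; ∈-++⁺ˡ; ∈-++⁺ʳ; ∈-∃++; ∈-filter⁻; ∈-filter⁺)
open import Data.List.Relation.Unary.Any as Any using (here; there; any?)
open import Data.List.Relation.Unary.All as All using (All; []; _∷_)
open import Data.List.Relation.Unary.Unique.Propositional using (Unique; []; _∷_)
open import Data.List.Relation.Unary.Unique.Propositional.Properties using (++⁺; Unique[x∷xs]⇒x∉xs)
open import Data.List.Extrema.Nat using (argmin; argmin-sel; f[argmin]≤f[xs])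
open import Data.List.Extrema.Nat using (argmax; argmax-sel; f[xs]≤f[argmax]; f[⊥]≤f[argmax]; f[argmax]<v⁺)
open import Relation.Binary.Definitions using (DecidableEquality; tri<; tri≈; tri>)
open import Relation.Binary.PropositionalEquality using (_≡_; _≢_; refl; sym; trans; cong; subst; subst₂)
open import Relation.Nullary using (¬_; Dec; yes; no; _×-dec_; _⊎-dec_)
open import Relation.Nullary.Decidable using (map′; ¬?; decidable-stable)
open import Relation.Unary using (Decidable)
open import Function.Bundles using (_⇔_; mk⇔; Equivalence)

-- Precedes s e e' and e ≺[ c ] e' of Defs are e ⊏[ s ] e' and res e ⊏[ c ] inv e'.
_⊏[_]_ : {A : Set} → A → List A → A → Set
a ⊏[ xs ] b = ∃[ p ] ∃[ r ] (xs ≡ p ++ a ∷ r × b ∈ r)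

module _ {A : Set} where

  Unique-++⁻ˡ : (xs ys : List A) → Unique (xs ++ ys) → Unique xs
  Unique-++⁻ˡ [] ys _ = []
  Unique-++⁻ˡ (x ∷ xs) ys (x∉ ∷ u) = prefix xs x∉ ∷ Unique-++⁻ˡ xs ys u
    where
    prefix : ∀ {P : A → Set} (zs : List A) → All P (zs ++ ys) → All P zs
    prefix [] _ = []
    prefix (_ ∷ zs) (p ∷ ps) = p ∷ prefix zs ps

  Unique-++⁻ʳ : (xs ys : List A) → Unique (xs ++ ys) → Unique ys
  Unique-++⁻ʳ [] ys u = u
  Unique-++⁻ʳ (_ ∷ xs) ys (_ ∷ u) = Unique-++⁻ʳ xs ys u

  Unique-++⇒∉ : ∀ {x} (xs ys : List A) → Unique (xs ++ ys) → x ∈ ys → x ∉ xs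
  Unique-++⇒∉ (y ∷ xs) ys u x∈ys (here refl) = Unique[x∷xs]⇒x∉xs u (∈-++⁺ʳ xs x∈ys)
  Unique-++⇒∉ (y ∷ xs) ys (_ ∷ u) x∈ys (there x∈xs) = Unique-++⇒∉ xs ys u x∈ys x∈xs

  ⊏⇒∈ˡ : ∀ {a b} {xs : List A} → a ⊏[ xs ] b → a ∈ xs
  ⊏⇒∈ˡ (p , r , refl , _) = ∈-++⁺ʳ p (here refl)

  ⊏⇒∈ʳ : ∀ {a b} {xs : List A} → a ⊏[ xs ] b → b ∈ xs
  ⊏⇒∈ʳ (p , r , refl , b∈r) = ∈-++⁺ʳ p (there b∈r)

  ⊏-[] : ∀ {a b} → ¬ a ⊏[ [] {A = A} ] b
  ⊏-[] ([] , _ , () , _)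
  ⊏-[] (_ ∷ _ , _ , () , _)

  ⊏-snoc : ∀ {a b w} (xs : List A) → a ⊏[ xs ++ w ∷ [] ] b → a ⊏[ xs ] b ⊎ (a ∈ xs × b ≡ w)
  ⊏-snoc [] ([] , .[] , refl , ())
  ⊏-snoc {a} [] (_ ∷ p , r , eq , _) with ++-conicalʳ p (a ∷ r) (sym (proj₂ (∷-injective eq)))
  ... | ()
  ⊏-snoc (x ∷ xs) ([] , r , refl , b∈r) with ∈-++⁻ xs b∈r
  ... | inj₁ b∈xs = inj₁ ([] , xs , refl , b∈xs)
  ... | inj₂ (here refl) = inj₂ (here refl , refl)
  ⊏-snoc (x ∷ xs) (_ ∷ p , r , eq , b∈r) with ∷-injective eq
  ... | refl , eq' with ⊏-snoc xs (p , r , eq' , b∈r)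
  ...   | inj₁ (p' , r' , refl , b∈) = inj₁ (x ∷ p' , r' , refl , b∈)
  ...   | inj₂ (a∈xs , b≡w) = inj₂ (there a∈xs , b≡w)

  ∃∈? : {P : A → Set} → Decidable P → (xs : List A) → Dec (∃[ x ] (x ∈ xs × P x))
  ∃∈? P? xs = map′ find (λ (_ , x∈ , px) → lose x∈ px) (any? P? xs)

  splitAt-length : ∀ k (xs : List A) → k ≤ length xs → ∃[ ys ] ∃[ zs ] (xs ≡ ys ++ zs × length ys ≡ k)
  splitAt-length zero xs _ = [] , xs , refl , refl
  splitAt-length (suc k) (x ∷ xs) (s≤s k≤) with splitAt-length k xs k≤
  ... | ys , zs , refl , refl = x ∷ ys , zs , refl , refl

  ∈-++-middle : ∀ {x a} (p r : List A) → x ∈ p → x ⊏[ p ++ a ∷ r ] a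
  ∈-++-middle {a = a} p r x∈p with ∈-∃++ x∈p
  ... | p₁ , p₂ , refl = p₁ , p₂ ++ a ∷ r , ++-assoc p₁ _ (a ∷ r) , ∈-++⁺ʳ p₂ (here refl)

  ⊏-++ʳ : ∀ {a b} (p : List A) {r} → a ⊏[ r ] b → a ⊏[ p ++ r ] b
  ⊏-++ʳ p (p₁ , r₁ , refl , b∈) = p ++ p₁ , r₁ , sym (++-assoc p p₁ _) , b∈

  minimalBy : {P : A → Set} → Decidable P → (k : A → ℕ) → ∀ {x} (xs : List A) → x ∈ xs → P x →
              ∃[ m ] (m ∈ xs × P m × (∀ {y} → y ∈ xs → P y → k m ≤ k y))
  minimalBy {P} P? k {x} xs x∈xs px = m , m∈xs , pm , minimal
    where
    m : A
    m = argmin k x (filter P? xs)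
    minimal : ∀ {y} → y ∈ xs → P y → k m ≤ k y
    minimal y∈ py = All.lookup (f[argmin]≤f[xs] {f = k} x (filter P? xs)) (∈-filter⁺ P? y∈ py)
    m∈xs×pm : m ∈ xs × P m
    m∈xs×pm with argmin-sel k x (filter P? xs)
    ... | inj₁ m≡x = subst (_∈ xs) (sym m≡x) x∈xs , subst P (sym m≡x) px
    ... | inj₂ m∈ = ∈-filter⁻ P? m∈
    m∈xs : m ∈ xs
    m∈xs = proj₁ m∈xs×pm
    pm : P m
    pm = proj₂ m∈xs×pm

module Positions {A : Set} (_≟_ : DecidableEquality A) where

  position : A → List A → ℕ
  position a [] = 0
  position a (b ∷ xs) with a ≟ b
  ... | yes _ = 0
  ... | no _ = suc (position a xs)

  position-++-∉ : ∀ {a} (p r : List A) → a ∉ p → position a (p ++ r) ≡ length p + position a r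
  position-++-∉ [] r _ = refl
  position-++-∉ {a} (b ∷ p) r a∉ with a ≟ b
  ... | yes a≡b = ⊥-elim (a∉ (here a≡b))
  ... | no _ = cong suc (position-++-∉ p r (λ a∈ → a∉ (there a∈)))

  position-++-∈ : ∀ {a} (p r : List A) → a ∈ p → position a (p ++ r) < length p
  position-++-∈ {a} (b ∷ p) r a∈ with a ≟ b
  ... | yes _ = s≤s z≤n
  position-++-∈ {a} (b ∷ p) r (here a≡b) | no a≢b = ⊥-elim (a≢b a≡b)
  position-++-∈ {a} (b ∷ p) r (there a∈) | no _ = s≤s (position-++-∈ p r a∈)

  position-<⇒∈ : ∀ {a} (p r : List A) → position a (p ++ r) < length p → a ∈ p
  position-<⇒∈ {a} [] r ()
  position-<⇒∈ {a} (b ∷ p) r lt with a ≟ b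
  ... | yes a≡b = here a≡b
  ... | no _ = there (position-<⇒∈ p r (s≤s⁻¹ lt))

  ∈-prefix⇔position< : ∀ {a xs} (p r : List A) → xs ≡ p ++ r → (a ∈ p ⇔ position a xs < length p)
  ∈-prefix⇔position< p r refl = mk⇔ (position-++-∈ p r) (position-<⇒∈ p r)

  position-middle : ∀ {a} (p r : List A) → Unique (p ++ a ∷ r) → position a (p ++ a ∷ r) ≡ length p
  position-middle {a} p r u with a ≟ a | position-++-∉ p (a ∷ r) (Unique-++⇒∉ p (a ∷ r) u (here refl))
  ... | yes _ | eq = trans eq (+-identityʳ (length p))
  ... | no a≢a | _ = ⊥-elim (a≢a refl)

  position-≢ : ∀ {a b} (r : List A) → b ≢ a → position b (a ∷ r) ≡ suc (position b r)
  position-≢ {a} {b} r b≢a with b ≟ a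
  ... | yes b≡a = ⊥-elim (b≢a b≡a)
  ... | no _ = refl

  ⊏⇒position< : ∀ {a b xs} → Unique xs → a ⊏[ xs ] b → position a xs < position b xs
  ⊏⇒position< {a} {b} u (p , r , refl , b∈r) = begin-strict
    position a (p ++ a ∷ r)        ≡⟨ position-middle p r u ⟩
    length p                       <⟨ m<m+n (length p) (s≤s z≤n) ⟩
    length p + suc (position b r)  ≡⟨ cong (length p +_) (sym (position-≢ r b≢a)) ⟩
    length p + position b (a ∷ r)  ≡⟨ sym (position-++-∉ p (a ∷ r) (Unique-++⇒∉ p (a ∷ r) u (there b∈r))) ⟩
    position b (p ++ a ∷ r)        ∎
    where
    open ≤-Reasoning
    b≢a : b ≢ a
    b≢a refl = Unique[x∷xs]⇒x∉xs (Unique-++⁻ʳ p (a ∷ r) u) b∈r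

  ⊏-asym : ∀ {a b xs} → Unique xs → a ⊏[ xs ] b → b ⊏[ xs ] a → ⊥
  ⊏-asym u a⊏b b⊏a = <-asym (⊏⇒position< u a⊏b) (⊏⇒position< u b⊏a)

  position-injective : ∀ {a b} (xs : List A) → a ∈ xs → b ∈ xs → position a xs ≡ position b xs → a ≡ b
  position-injective {a} {b} (x ∷ xs) a∈ b∈ eq with a ≟ x | b ≟ x
  ... | yes refl | yes refl = refl
  ... | yes _ | no _ = ⊥-elim (0≢1+n eq)
  ... | no _ | yes _ = ⊥-elim (0≢1+n (sym eq))
  position-injective (x ∷ xs) (here a≡x) _ eq | no a≢x | no _ = ⊥-elim (a≢x a≡x)
  position-injective (x ∷ xs) (there _) (here b≡x) eq | no _ | no b≢x = ⊥-elim (b≢x b≡x)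
  position-injective (x ∷ xs) (there a∈) (there b∈) eq | no _ | no _ = position-injective xs a∈ b∈ (suc-injective eq)

  position<⇒⊏ : ∀ {a b} (xs : List A) → a ∈ xs → b ∈ xs → position a xs < position b xs → a ⊏[ xs ] b
  position<⇒⊏ {a} {b} (x ∷ xs) a∈ b∈ lt with a ≟ x | b ≟ x
  ... | _ | yes _ = ⊥-elim (n≮0 lt)
  ... | yes refl | no b≢x = [] , xs , refl , tail b∈
    where
    tail : b ∈ x ∷ xs → b ∈ xs
    tail (here b≡x) = ⊥-elim (b≢x b≡x)
    tail (there b∈xs) = b∈xs
  position<⇒⊏ (x ∷ xs) (here a≡x) _ _ | no a≢x | no _ = ⊥-elim (a≢x a≡x)
  position<⇒⊏ (x ∷ xs) (there _) (here b≡x) _ | no _ | no b≢x = ⊥-elim (b≢x b≡x)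
  position<⇒⊏ (x ∷ xs) (there a∈) (there b∈) lt | no _ | no _ with position<⇒⊏ xs a∈ b∈ (s≤s⁻¹ lt)
  ... | p , r , refl , b∈r = x ∷ p , r , refl , b∈r

  ⊏-split⇒∈ : ∀ {a b xs} (p r : List A) → Unique xs → xs ≡ p ++ a ∷ r → b ⊏[ xs ] a → b ∈ p
  ⊏-split⇒∈ {b = b} p r u refl b⊏a =
    position-<⇒∈ p (_ ∷ r) (subst (position b (p ++ _ ∷ r) <_) (position-middle p r u) (⊏⇒position< u b⊏a))

  ∈-prefix⇔⊏ : ∀ {a b xs} (p r : List A) → Unique xs → xs ≡ p ++ a ∷ r → b ∈ p ⇔ b ⊏[ xs ] a
  ∈-prefix⇔⊏ p r u refl = mk⇔ (∈-++-middle p r) (⊏-split⇒∈ p r u refl)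

  ⊏-prefix : ∀ {a b xs} (p r : List A) → Unique xs → xs ≡ p ++ r → b ∈ p → a ⊏[ xs ] b → a ⊏[ p ] b
  ⊏-prefix {b = b} p r u refl b∈p a⊏b with ∈-∃++ b∈p
  ... | p₁ , p₂ , refl = ∈-++-middle p₁ p₂ (⊏-split⇒∈ p₁ (p₂ ++ r) u (++-assoc p₁ (b ∷ p₂) r) a⊏b)

  ⊏-connex : ∀ {a b} {xs : List A} → a ∈ xs → b ∈ xs → a ≢ b → a ⊏[ xs ] b ⊎ b ⊏[ xs ] a
  ⊏-connex {a} {b} {xs} a∈ b∈ a≢b with <-cmp (position a xs) (position b xs)
  ... | tri< lt _ _ = inj₁ (position<⇒⊏ xs a∈ b∈ lt)
  ... | tri≈ _ eq _ = ⊥-elim (a≢b (position-injective xs a∈ b∈ eq))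
  ... | tri> _ _ gt = inj₂ (position<⇒⊏ xs b∈ a∈ gt)

  delete : A → List A → List A
  delete x = filter (λ y → ¬? (y ≟ x))

  ∈-delete⁻ : ∀ x xs {y} → y ∈ delete x xs → y ∈ xs × y ≢ x
  ∈-delete⁻ x xs = ∈-filter⁻ (λ y → ¬? (y ≟ x)) {xs = xs}

  ∈-delete⁺ : ∀ {x y xs} → y ∈ xs → y ≢ x → y ∈ delete x xs
  ∈-delete⁺ = ∈-filter⁺ (λ y → ¬? (y ≟ _))

  length-delete : ∀ {x} (xs : List A) → x ∈ xs → length (delete x xs) < length xs
  length-delete {x} xs x∈ = filter-notAll (λ y → ¬? (y ≟ x)) xs (Any.map (λ x≡y y≢x → y≢x (sym x≡y)) x∈)

  module Deleting (x : A) (xs : List A) where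

    kept : ∀ {y} → y ∈ delete x xs → y ∈ xs
    kept y∈ = proj₁ (∈-delete⁻ x xs y∈)

    deleted≢ : ∀ {y} → y ∈ delete x xs → y ≢ x
    deleted≢ y∈ = proj₂ (∈-delete⁻ x xs y∈)

_≟ₒ_ : DecidableEquality Op
enq x ≟ₒ enq y = map′ (cong enq) (λ { refl → refl }) (x ≟ℕ y)
deq r ≟ₒ deq r' = map′ (cong deq) (λ { refl → refl }) (≡-dec _≟ℕ_ r r')
enq _ ≟ₒ deq _ = no λ ()
deq _ ≟ₒ enq _ = no λ ()

_≟ₑ_ : DecidableEquality Event
mkEv u o ≟ₑ mkEv u' o' = map′ (λ { (refl , refl) → refl }) (λ { refl → refl , refl }) ((u ≟ℕ u') ×-dec (o ≟ₒ o'))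

_≟ₐ_ : DecidableEquality Action
inv e ≟ₐ inv e' = map′ (cong inv) (λ { refl → refl }) (e ≟ₑ e')
res e ≟ₐ res e' = map′ (cong res) (λ { refl → refl }) (e ≟ₑ e')
inv _ ≟ₐ res _ = no λ ()
res _ ≟ₐ inv _ = no λ ()

data IsEnq : Event → ℕ → Set where
  isEnq : ∀ {u x} → IsEnq (mkEv u (enq x)) x

data IsDeq : Event → ℕ → Set where
  isDeq : ∀ {u x} → IsDeq (mkEv u (deq (just x))) x

data IsNullDeq : Event → Set where
  isNullDeq : ∀ {u} → IsNullDeq (mkEv u (deq nothing))

enq⇒IsEnq : ∀ {e x} → op e ≡ enq x → IsEnq e x
enq⇒IsEnq {mkEv _ _} refl = isEnq

IsEnq⇒enq : ∀ {e x} → IsEnq e x → op e ≡ enq x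
IsEnq⇒enq isEnq = refl

deq⇒IsDeq : ∀ {e x} → op e ≡ deq (just x) → IsDeq e x
deq⇒IsDeq {mkEv _ _} refl = isDeq

IsDeq⇒deq : ∀ {e x} → IsDeq e x → op e ≡ deq (just x)
IsDeq⇒deq isDeq = refl

null⇒IsNullDeq : ∀ {e} → op e ≡ deq nothing → IsNullDeq e
null⇒IsNullDeq {mkEv _ _} refl = isNullDeq

IsNullDeq⇒null : ∀ {e} → IsNullDeq e → op e ≡ deq nothing
IsNullDeq⇒null isNullDeq = refl

IsEnq-functional : ∀ {e x y} → IsEnq e x → IsEnq e y → x ≡ y
IsEnq-functional isEnq isEnq = refl

IsDeq-functional : ∀ {e x y} → IsDeq e x → IsDeq e y → x ≡ y
IsDeq-functional isDeq isDeq = refl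

IsEnq? : ∀ e x → Dec (IsEnq e x)
IsEnq? (mkEv _ (enq y)) x = map′ (λ { refl → isEnq }) (λ { isEnq → refl }) (y ≟ℕ x)
IsEnq? (mkEv _ (deq _)) x = no λ ()

IsDeq? : ∀ e x → Dec (IsDeq e x)
IsDeq? (mkEv _ (deq (just y))) x = map′ (λ { refl → isDeq }) (λ { isDeq → refl }) (y ≟ℕ x)
IsDeq? (mkEv _ (deq nothing)) x = no λ ()
IsDeq? (mkEv _ (enq _)) x = no λ ()

IsNullDeq? : ∀ e → Dec (IsNullDeq e)
IsNullDeq? (mkEv _ (deq nothing)) = yes isNullDeq
IsNullDeq? (mkEv _ (deq (just _))) = no λ ()
IsNullDeq? (mkEv _ (enq _)) = no λ ()

enq-not-deq : ∀ {e x y} → IsEnq e x → ¬ IsDeq e y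
enq-not-deq isEnq ()

deq-not-enq : ∀ {e x y} → IsDeq e x → ¬ IsEnq e y
deq-not-enq isDeq ()

null-not-enq : ∀ {e y} → IsNullDeq e → ¬ IsEnq e y
null-not-enq isNullDeq ()

null-not-deq : ∀ {e y} → IsNullDeq e → ¬ IsDeq e y
null-not-deq isNullDeq ()

HasEnq HasDeq : List Event → ℕ → Set
HasEnq es x = ∃[ e ] (e ∈ es × IsEnq e x)
HasDeq es x = ∃[ d ] (d ∈ es × IsDeq d x)

EnqueuesDistinct : List Event → Set
EnqueuesDistinct es = ∀ {e e' x} → e ∈ es → e' ∈ es → IsEnq e x → IsEnq e' x → e ≡ e'

module Ev = Positions _≟ₑ_
module Act = Positions _≟ₐ_
module Val = Positions _≟ℕ_

open Ev using (delete; ∈-delete⁺; length-delete; module Deleting)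

HasEnq? : ∀ evs x → Dec (HasEnq evs x)
HasEnq? evs x = ∃∈? (λ e → IsEnq? e x) evs

HasDeq? : ∀ evs x → Dec (HasDeq evs x)
HasDeq? evs x = ∃∈? (λ d → IsDeq? d x) evs

HasEnq-delete : ∀ {x y evs} → ¬ IsEnq x y → HasEnq evs y → HasEnq (delete x evs) y
HasEnq-delete not-x (e , e∈ , isE) = e , ∈-delete⁺ e∈ (λ { refl → not-x isE }) , isE

HasDeq-delete : ∀ {x y evs} → ¬ IsDeq x y → HasDeq evs y → HasDeq (delete x evs) y
HasDeq-delete not-x (d , d∈ , isD) = d , ∈-delete⁺ d∈ (λ { refl → not-x isD }) , isD

enqueued dequeued : List Event → List ℕ
enqueued [] = []
enqueued (mkEv _ (enq x) ∷ es) = x ∷ enqueued es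
enqueued (mkEv _ (deq _) ∷ es) = enqueued es
dequeued [] = []
dequeued (mkEv _ (enq _) ∷ es) = dequeued es
dequeued (mkEv _ (deq (just x)) ∷ es) = x ∷ dequeued es
dequeued (mkEv _ (deq nothing) ∷ es) = dequeued es

∈-enqueued⁻ : ∀ {x} es → x ∈ enqueued es → HasEnq es x
∈-enqueued⁻ (mkEv _ (enq _) ∷ es) (here refl) = _ , here refl , isEnq
∈-enqueued⁻ (mkEv _ (enq _) ∷ es) (there x∈) with ∈-enqueued⁻ es x∈
... | e , e∈ , isE = e , there e∈ , isE
∈-enqueued⁻ (mkEv _ (deq _) ∷ es) x∈ with ∈-enqueued⁻ es x∈
... | e , e∈ , isE = e , there e∈ , isE

∈-dequeued⁻ : ∀ {x} es → x ∈ dequeued es → HasDeq es x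
∈-dequeued⁻ (mkEv _ (enq _) ∷ es) x∈ with ∈-dequeued⁻ es x∈
... | d , d∈ , isD = d , there d∈ , isD
∈-dequeued⁻ (mkEv _ (deq (just _)) ∷ es) (here refl) = _ , here refl , isDeq
∈-dequeued⁻ (mkEv _ (deq (just _)) ∷ es) (there x∈) with ∈-dequeued⁻ es x∈
... | d , d∈ , isD = d , there d∈ , isD
∈-dequeued⁻ (mkEv _ (deq nothing) ∷ es) x∈ with ∈-dequeued⁻ es x∈
... | d , d∈ , isD = d , there d∈ , isD

∈-enqueued⁺ : ∀ {e x} es → e ∈ es → IsEnq e x → x ∈ enqueued es
∈-enqueued⁺ (mkEv _ (enq _) ∷ es) (here refl) isEnq = here refl
∈-enqueued⁺ (mkEv _ (enq _) ∷ es) (there e∈) isE = there (∈-enqueued⁺ es e∈ isE)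
∈-enqueued⁺ (mkEv _ (deq _) ∷ es) (here refl) ()
∈-enqueued⁺ (mkEv _ (deq _) ∷ es) (there e∈) isE = ∈-enqueued⁺ es e∈ isE

∈-dequeued⁺ : ∀ {d x} es → d ∈ es → IsDeq d x → x ∈ dequeued es
∈-dequeued⁺ (mkEv _ (enq _) ∷ es) (here refl) ()
∈-dequeued⁺ (mkEv _ (enq _) ∷ es) (there d∈) isD = ∈-dequeued⁺ es d∈ isD
∈-dequeued⁺ (mkEv _ (deq (just _)) ∷ es) (here refl) isDeq = here refl
∈-dequeued⁺ (mkEv _ (deq (just _)) ∷ es) (there d∈) isD = there (∈-dequeued⁺ es d∈ isD)
∈-dequeued⁺ (mkEv _ (deq nothing) ∷ es) (here refl) ()
∈-dequeued⁺ (mkEv _ (deq nothing) ∷ es) (there d∈) isD = ∈-dequeued⁺ es d∈ isD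

enqueued-++ : ∀ es es' → enqueued (es ++ es') ≡ enqueued es ++ enqueued es'
enqueued-++ [] es' = refl
enqueued-++ (mkEv _ (enq x) ∷ es) es' = cong (x ∷_) (enqueued-++ es es')
enqueued-++ (mkEv _ (deq _) ∷ es) es' = enqueued-++ es es'

enqueued-unique : ∀ es → Unique es → EnqueuesDistinct es → Unique (enqueued es)
enqueued-unique [] _ _ = []
enqueued-unique (mkEv _ (enq x) ∷ es) (e∉ ∷ u) distinct =
  All.tabulate (λ y∈ x≡y → differs y∈ x≡y) ∷ enqueued-unique es u (λ e∈ e'∈ → distinct (there e∈) (there e'∈))
  where
  differs : ∀ {y} → y ∈ enqueued es → x ≡ y → ⊥
  differs y∈ refl with ∈-enqueued⁻ es y∈
  ... | e , e∈ , isE = All.lookup e∉ e∈ (distinct (here refl) (there e∈) isEnq isE)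
enqueued-unique (mkEv _ (deq _) ∷ es) (_ ∷ u) distinct =
  enqueued-unique es u (λ e∈ e'∈ → distinct (there e∈) (there e'∈))

run-++ : ∀ {q} es rest → Run q (es ++ rest) → ∃[ q' ] (Run q' rest × q ++ enqueued es ≡ dequeued es ++ q')
run-++ {q} [] rest r = q , r , ++-identityʳ q
run-++ {q} (_ ∷ es) rest (stEnq {x = x} r) with run-++ es rest r
... | q' , r' , eq = q' , r' , trans (sym (++-assoc q (x ∷ []) (enqueued es))) eq
run-++ (_ ∷ es) rest (stDeq r) with run-++ es rest r
... | q' , r' , eq = q' , r' , cong (_ ∷_) eq
run-++ (_ ∷ es) rest (stNul r) = run-++ es rest r

Run-deq-head : ∀ {q d rest x} → Run q (d ∷ rest) → IsDeq d x → ∃[ q' ] (q ≡ x ∷ q')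
Run-deq-head (stDeq _) isDeq = _ , refl

Run-null-empty : ∀ {q d rest} → Run q (d ∷ rest) → IsNullDeq d → q ≡ []
Run-null-empty (stNul _) isNullDeq = refl

Run-enq : ∀ {q e x s} → IsEnq e x → Run (q ++ x ∷ []) s → Run q (e ∷ s)
Run-enq isEnq = stEnq

Run-deq : ∀ {q d x s} → IsDeq d x → Run q s → Run (x ∷ q) (d ∷ s)
Run-deq isDeq = stDeq

Run-null : ∀ {n s} → IsNullDeq n → Run [] s → Run [] (n ∷ s)
Run-null isNullDeq = stNul

enqueued-⊏ : ∀ {es ey ex x y} → ey ⊏[ es ] ex → IsEnq ey y → IsEnq ex x → y ⊏[ enqueued es ] x
enqueued-⊏ (p , r , refl , ex∈r) isEnq isE = enqueued p , enqueued r , enqueued-++ p _ , ∈-enqueued⁺ r ex∈r isE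

queue-before : ∀ es {d rest x} → Legal (es ++ d ∷ rest) → IsDeq d x →
               ∃[ q ] (enqueued es ≡ dequeued es ++ x ∷ q)
queue-before es {d} {rest} legal isD with run-++ es (d ∷ rest) legal
... | _ , r , eq with Run-deq-head r isD
...   | q , refl = q , eq

legal-deq-enqueued : ∀ es {d rest x} → Legal (es ++ d ∷ rest) → IsDeq d x → HasEnq es x
legal-deq-enqueued es legal isD with queue-before es legal isD
... | _ , eq = ∈-enqueued⁻ es (subst (_ ∈_) (sym eq) (∈-++⁺ʳ (dequeued es) (here refl)))

legal-null-drained : ∀ es {d rest x} → Legal (es ++ d ∷ rest) → IsNullDeq d → HasEnq es x → HasDeq es x
legal-null-drained es {d} {rest} legal isN (e , e∈ , isE) with run-++ es (d ∷ rest) legal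
... | _ , r , eq with Run-null-empty r isN
...   | refl = ∈-dequeued⁻ es (subst (_ ∈_) (trans eq (++-identityʳ (dequeued es))) (∈-enqueued⁺ es e∈ isE))

legal-deq-once : ∀ es {d rest x} → Legal (es ++ d ∷ rest) → Unique (enqueued es) → IsDeq d x → ¬ HasDeq es x
legal-deq-once es legal u isD (d' , d'∈ , isD') with queue-before es legal isD
... | q , eq = Unique-++⇒∉ (dequeued es) (_ ∷ q) (subst Unique eq u) (here refl) (∈-dequeued⁺ es d'∈ isD')

legal-fifo : ∀ es {d rest x y ex ey} → Legal (es ++ d ∷ rest) → Unique (enqueued es) → IsDeq d x →
             ey ⊏[ es ] ex → IsEnq ey y → IsEnq ex x → HasDeq es y
legal-fifo es {x = x} {y} legal u isD ey⊏ex isEy isEx with queue-before es legal isD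
... | q , eq = fifo (∈-++⁻ (dequeued es) (subst (y ∈_) eq (⊏⇒∈ˡ y⊏x)))
  where
  y⊏x : y ⊏[ enqueued es ] x
  y⊏x = enqueued-⊏ ey⊏ex isEy isEx
  fifo : y ∈ dequeued es ⊎ y ∈ x ∷ q → HasDeq es y
  fifo (inj₁ y∈) = ∈-dequeued⁻ es y∈
  fifo (inj₂ (here refl)) = ⊥-elim (Val.⊏-asym u y⊏x y⊏x)
  fifo (inj₂ (there y∈q)) = ⊥-elim (Val.⊏-asym u y⊏x (dequeued es , q , eq , y∈q))

events : History → List Event
events [] = []
events (inv e ∷ c) = e ∷ events c
events (res _ ∷ c) = events c

∈-events⇔ : ∀ {e} c → e ∈ events c ⇔ EvOf c e
∈-events⇔ c = mk⇔ (to c) (from c)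
  where
  to : ∀ {e} c → e ∈ events c → inv e ∈ c
  to (inv _ ∷ c) (here refl) = here refl
  to (inv _ ∷ c) (there e∈) = there (to c e∈)
  to (res _ ∷ c) e∈ = there (to c e∈)
  from : ∀ {e} c → inv e ∈ c → e ∈ events c
  from (inv _ ∷ c) (here refl) = here refl
  from (inv _ ∷ c) (there e∈) = there (from c e∈)
  from (res _ ∷ c) (there e∈) = from c e∈

module Times (c : History) (wf : WellFormed c) where

  U : Unique c
  U = proj₁ wf

  I R : Event → ℕ
  I e = Act.position (inv e) c
  R e = Act.position (res e) c

  ≺⇒< : ∀ {e e'} → e ≺[ c ] e' → R e < I e'
  ≺⇒< = Act.⊏⇒position< U

  <⇒≺ : ∀ {e e'} → res e ∈ c → inv e' ∈ c → R e < I e' → e ≺[ c ] e'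
  <⇒≺ = Act.position<⇒⊏ c

  I<R : ∀ {e} → res e ∈ c → I e < R e
  I<R {e} res∈ with proj₁ (proj₂ wf) e res∈
  ... | p , r , eq , inv∈p = Act.⊏⇒position< U (subst (λ c' → inv e ⊏[ c' ] res e) (sym eq) (∈-++-middle p r inv∈p))

  res∈⇒inv∈ : ∀ {e} → res e ∈ c → inv e ∈ c
  res∈⇒inv∈ {e} res∈ with proj₁ (proj₂ wf) e res∈
  ... | p , r , eq , inv∈p = subst (inv e ∈_) (sym eq) (∈-++⁺ˡ inv∈p)

  I≢R : ∀ {e e'} → inv e ∈ c → res e' ∈ c → I e ≢ R e'
  I≢R inv∈ res∈ eq with Act.position-injective c inv∈ res∈ eq
  ... | ()

  ≤⇒≺ : ∀ {e e'} → res e ∈ c → inv e' ∈ c → R e ≤ I e' → e ≺[ c ] e'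
  ≤⇒≺ res∈ inv∈ Re≤Ie' = <⇒≺ res∈ inv∈ (≤∧≢⇒< Re≤Ie' (λ Re≡Ie' → I≢R inv∈ res∈ (sym Re≡Ie')))

  times-of-split : ∀ {d c₀ cd c₃} → c ≡ c₀ ++ inv d ∷ cd ++ res d ∷ c₃ →
                   I d ≡ length c₀ × R d ≡ length c₀ + suc (length cd)
  times-of-split {d} {c₀} {cd} {c₃} eq =
    trans (cong (Act.position (inv d)) eq) (Act.position-middle c₀ _ (subst Unique eq U)) ,
    trans (cong (Act.position (res d)) eq')
          (trans (Act.position-middle (c₀ ++ inv d ∷ cd) c₃ (subst Unique eq' U)) (length-++ c₀))
    where
    eq' : c ≡ (c₀ ++ inv d ∷ cd) ++ res d ∷ c₃
    eq' = trans eq (sym (++-assoc c₀ (inv d ∷ cd) _))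

  cut : ∀ {d c₀ cd c₃ c₁ c₂} → c ≡ c₀ ++ inv d ∷ cd ++ res d ∷ c₃ → cd ≡ c₁ ++ c₂ →
        c ≡ (c₀ ++ inv d ∷ c₁) ++ c₂ ++ res d ∷ c₃
  cut {d} {c₀} {cd} {c₃} {c₁} {c₂} eq refl =
    trans eq (trans (cong (λ z → c₀ ++ inv d ∷ z) (++-assoc c₁ c₂ _)) (sym (++-assoc c₀ (inv d ∷ c₁) _)))

  length-cut : ∀ {d c₀ cd c₃} c₁ → c ≡ c₀ ++ inv d ∷ cd ++ res d ∷ c₃ →
               length (c₀ ++ inv d ∷ c₁) ≡ I d + suc (length c₁)
  length-cut {c₀ = c₀} c₁ eq = trans (length-++ c₀) (cong (_+ suc (length c₁)) (sym (proj₁ (times-of-split eq))))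

  ∈-cut⇔ : ∀ {d c₀ cd c₃ c₁ c₂} → c ≡ c₀ ++ inv d ∷ cd ++ res d ∷ c₃ → cd ≡ c₁ ++ c₂ →
           ∀ {α} → α ∈ c₀ ++ inv d ∷ c₁ ⇔ Act.position α c < I d + suc (length c₁)
  ∈-cut⇔ {d} {c₀} {cd} {c₃} {c₁} {c₂} eq eq-cd {α} =
    subst (λ t → α ∈ c₀ ++ inv d ∷ c₁ ⇔ Act.position α c < t) (length-cut c₁ eq)
          (Act.∈-prefix⇔position< (c₀ ++ inv d ∷ c₁) (c₂ ++ res d ∷ c₃) (cut eq eq-cd))

  cut-after : ∀ {d c₀ cd c₃ t} → c ≡ c₀ ++ inv d ∷ cd ++ res d ∷ c₃ → I d ≤ t → t < R d →
              ∃[ c₁ ] ∃[ c₂ ] (cd ≡ c₁ ++ c₂ × (∀ {α} → α ∈ c₀ ++ inv d ∷ c₁ ⇔ Act.position α c ≤ t))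
  cut-after {d} {c₀} {cd} {c₃} {t} eq Id≤t t<Rd with splitAt-length (t ∸ I d) cd t∸Id≤|cd|
    where
    Id+[t∸Id]≡t : I d + (t ∸ I d) ≡ t
    Id+[t∸Id]≡t = m+[n∸m]≡n Id≤t
    t∸Id≤|cd| : t ∸ I d ≤ length cd
    t∸Id≤|cd| = s≤s⁻¹ (+-cancelˡ-< (I d) _ _ (subst₂ _<_ (sym Id+[t∸Id]≡t) Rd≡ t<Rd))
      where
      Rd≡ : R d ≡ I d + suc (length cd)
      Rd≡ = trans (proj₂ (times-of-split eq)) (cong (_+ _) (sym (proj₁ (times-of-split eq))))
  ... | c₁ , c₂ , eq-cd , |c₁|≡ = c₁ , c₂ , eq-cd , mk⇔ to from
    where
    cut⇔ : ∀ {α} → α ∈ c₀ ++ inv d ∷ c₁ ⇔ Act.position α c < I d + suc (length c₁)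
    cut⇔ = ∈-cut⇔ {c₁ = c₁} {c₂} eq eq-cd
    Id+|c₁|≡t : I d + suc (length c₁) ≡ suc t
    Id+|c₁|≡t = trans (+-suc (I d) _) (cong suc (trans (cong (I d +_) |c₁|≡) (m+[n∸m]≡n Id≤t)))
    to : ∀ {α} → α ∈ c₀ ++ inv d ∷ c₁ → Act.position α c ≤ t
    to {α} α∈ = s≤s⁻¹ (subst (Act.position α c <_) Id+|c₁|≡t (Equivalence.to cut⇔ α∈))
    from : ∀ {α} → Act.position α c ≤ t → α ∈ c₀ ++ inv d ∷ c₁
    from {α} α≤t = Equivalence.from cut⇔ (subst (Act.position α c <_) (sym Id+|c₁|≡t) (s≤s α≤t))

  res∈-split : ∀ {d c₀ cd c₃} → c ≡ c₀ ++ inv d ∷ cd ++ res d ∷ c₃ → res d ∈ c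
  res∈-split {c₀ = c₀} {cd} eq = subst (_ ∈_) (sym eq) (∈-++⁺ʳ c₀ (there (∈-++⁺ʳ cd (here refl))))

  ∈-cut⇒∈ : ∀ {d c₀ cd c₃ c₁ c₂} → c ≡ c₀ ++ inv d ∷ cd ++ res d ∷ c₃ → cd ≡ c₁ ++ c₂ →
            ∀ {α} → α ∈ c₀ ++ inv d ∷ c₁ → α ∈ c
  ∈-cut⇒∈ eq eq-cd α∈ = subst (_ ∈_) (sym (cut eq eq-cd)) (∈-++⁺ˡ α∈)

-- A linearizable history has no violation

module Linearizable⇒NoViolation (c : History) (wf : WellFormed c) (eu : EnqUnique c)
  {s} (us : Unique s) (∈s⇔ : ∀ e → e ∈ s ⇔ EvOf c e) (legal : Legal s)
  (resp : ∀ e e' → e ≺[ c ] e' → Precedes s e e') where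

  open Times c wf

  toC : ∀ {e} → e ∈ s → EvOf c e
  toC {e} = Equivalence.to (∈s⇔ e)

  toS : ∀ {e} → EvOf c e → e ∈ s
  toS {e} = Equivalence.from (∈s⇔ e)

  split : ∀ {e} → EvOf c e → ∃[ a ] ∃[ b ] (s ≡ a ++ e ∷ b)
  split e∈ = ∈-∃++ (toS e∈)

  legal-prefix : ∀ {a d b} → s ≡ a ++ d ∷ b → Legal (a ++ d ∷ b)
  legal-prefix eq = subst Legal eq legal

  enqueued-unique-prefix : ∀ a {r} → s ≡ a ++ r → Unique (enqueued a)
  enqueued-unique-prefix a {r} eq = enqueued-unique a (Unique-++⁻ˡ a r (subst Unique eq us)) distinct
    where
    toC' : ∀ {e} → e ∈ a → EvOf c e
    toC' e∈ = toC (subst (_ ∈_) (sym eq) (∈-++⁺ˡ e∈))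
    distinct : EnqueuesDistinct a
    distinct e∈ e'∈ isE isE' = eu _ _ _ (toC' e∈ , IsEnq⇒enq isE) (toC' e'∈ , IsEnq⇒enq isE')

  before⇒∈ : ∀ {a d b e} → s ≡ a ++ d ∷ b → Precedes s e d → e ∈ a
  before⇒∈ {a} {b = b} eq = Equivalence.from (Ev.∈-prefix⇔⊏ a b us eq)

  ∈⇒before : ∀ {a d b e} → s ≡ a ++ d ∷ b → e ∈ a → Precedes s e d
  ∈⇒before {a} {b = b} eq = Equivalence.to (Ev.∈-prefix⇔⊏ a b us eq)

  enq-before-deq : ∀ {d x} → IsDeqOf c d (just x) → ∃[ e ] (IsEnqOf c e x × Precedes s e d)
  enq-before-deq {d} (d∈ , opd) with split d∈
  ... | a , b , eq with legal-deq-enqueued a (legal-prefix eq) (deq⇒IsDeq opd)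
  ...   | e , e∈a , isE = e , (toC (⊏⇒∈ˡ e⊏d) , IsEnq⇒enq isE) , e⊏d
    where
    e⊏d : Precedes s e d
    e⊏d = ∈⇒before eq e∈a

  deq-not-twice : ∀ {d d' x} → IsDeqOf c d (just x) → IsDeqOf c d' (just x) → ¬ Precedes s d d'
  deq-not-twice (_ , opd) (d'∈ , opd') d⊏d' with split d'∈
  ... | a , b , eq = legal-deq-once a (legal-prefix eq) (enqueued-unique-prefix a eq) (deq⇒IsDeq opd')
                       (_ , before⇒∈ eq d⊏d' , deq⇒IsDeq opd)

  deq-unique : ∀ {d d' x} → IsDeqOf c d (just x) → IsDeqOf c d' (just x) → d ≡ d'
  deq-unique {d} {d'} D D' with d ≟ₑ d'
  ... | yes d≡d' = d≡d'
  ... | no d≢d' with Ev.⊏-connex (toS (proj₁ D)) (toS (proj₁ D')) d≢d'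
  ...   | inj₁ d⊏d' = ⊥-elim (deq-not-twice D D' d⊏d')
  ...   | inj₂ d'⊏d = ⊥-elim (deq-not-twice D' D d'⊏d)

  fifo : ∀ {ey ex dx x y} → IsEnqOf c ey y → IsEnqOf c ex x → ey ≺[ c ] ex → IsDeqOf c dx (just x) →
         ∃[ dy ] (IsDeqOf c dy (just y) × Precedes s dy dx)
  fifo {ey} {ex} {dx} (_ , opy) Ex ey≺ex (dx∈ , opdx) with split dx∈
  ... | a , b , eq with legal-deq-enqueued a (legal-prefix eq) (deq⇒IsDeq opdx)
  ...   | ex' , ex'∈a , isEx' with eu _ _ _ (toC (⊏⇒∈ˡ (∈⇒before eq ex'∈a)) , IsEnq⇒enq isEx') Ex
  ...     | refl with legal-fifo a (legal-prefix eq) (enqueued-unique-prefix a eq) (deq⇒IsDeq opdx)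
                        (Ev.⊏-prefix a _ us eq ex'∈a (resp ey ex ey≺ex)) (enq⇒IsEnq opy) isEx'
  ...       | dy , dy∈a , isDy = dy , (toC (⊏⇒∈ˡ dy⊏dx) , IsDeq⇒deq isDy) , dy⊏dx
    where
    dy⊏dx : Precedes s dy dx
    dy⊏dx = ∈⇒before eq dy∈a

  null-drained : ∀ {d e x} → IsDeqOf c d nothing → IsEnqOf c e x → Precedes s e d →
                 ∃[ d' ] (IsDeqOf c d' (just x) × Precedes s d' d)
  null-drained {d} (d∈ , opd) (_ , ope) e⊏d with split d∈
  ... | a , b , eq with legal-null-drained a (legal-prefix eq) (null⇒IsNullDeq opd) (_ , before⇒∈ eq e⊏d , enq⇒IsEnq ope)
  ...   | d' , d'∈a , isD' = d' , (toC (⊏⇒∈ˡ d'⊏d) , IsDeq⇒deq isD') , d'⊏d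
    where
    d'⊏d : Precedes s d' d
    d'⊏d = ∈⇒before eq d'∈a

  no-fresh : ¬ VFresh c
  no-fresh (x , d , D , unfresh) with enq-before-deq D
  ... | e , E , e⊏d with unfresh
  ...   | inj₁ no-enq = no-enq (e , E)
  ...   | inj₂ (e' , E' , d≺e') with eu _ _ _ E' E
  ...     | refl = Ev.⊏-asym us (resp d e d≺e') e⊏d

  no-repet : ¬ VRepet c
  no-repet (x , d , d' , d≢d' , D , D') = d≢d' (deq-unique D D')

  no-ord : ¬ VOrd c
  no-ord (x , y , ex , ey , dx , Ex , Ey , ey≺ex , Dx , late) with fifo Ey Ex ey≺ex Dx
  ... | dy , Dy , dy⊏dx with late
  ...   | inj₁ no-deq = no-deq (dy , Dy)
  ...   | inj₂ (dy' , Dy' , dx≺dy') with deq-unique Dy Dy'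
  ...     | refl = Ev.⊏-asym us dy⊏dx (resp dx dy dx≺dy')

  linearized-before⇒invoked-before-response : ∀ {e d} → Precedes s e d → res d ∈ c → I e < R d
  linearized-before⇒invoked-before-response {e} {d} e⊏d res-d∈ =
    ≤∧≢⇒< (≮⇒≥ (λ Rd<Ie → Ev.⊏-asym us (resp d e (<⇒≺ res-d∈ inv-e∈ Rd<Ie)) e⊏d)) (I≢R inv-e∈ res-d∈)
    where
    inv-e∈ : inv e ∈ c
    inv-e∈ = toC (⊏⇒∈ˡ e⊏d)

  latest : Event → List Event → Event
  latest d a = argmax I d a

  latest<R : ∀ {a d b} → s ≡ a ++ d ∷ b → res d ∈ c → I (latest d a) < R d
  latest<R {a} eq res-d∈ = f[argmax]<v⁺ {f = I} (I<R res-d∈)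
    (All.tabulate (λ e∈a → linearized-before⇒invoked-before-response (∈⇒before eq e∈a) res-d∈))

  completed-before-latest : ∀ {a d b e} → s ≡ a ++ d ∷ b → EvOf c d → res e ∈ c →
                            R e ≤ I (latest d a) → Precedes s e d
  completed-before-latest {a} {d} {e = e} eq d∈ res-e∈ Re≤ with argmax-sel I d a
  ... | inj₁ m≡d = subst (Precedes s e) m≡d (resp e _ (≤⇒≺ res-e∈ (subst (λ z → inv z ∈ c) (sym m≡d) d∈) Re≤))
  ... | inj₂ m∈a =
    ∈⇒before eq (⊏⇒∈ˡ (Ev.⊏-prefix a _ us eq m∈a (resp e _ (≤⇒≺ res-e∈ (toC (⊏⇒∈ˡ (∈⇒before eq m∈a))) Re≤))))

  -- Cut the history right after the latest invocation among d and the events linearized before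
  -- it: every enqueue completed by then is linearized before d, hence dequeued before d, and
  -- those dequeues are already invoked.
  no-wit : ¬ VWit c
  no-wit (d , c₀ , cd , c₃ , D@(d∈ , _) , eqc , witness) with split d∈
  ... | a , b , eq with cut-after eqc (f[⊥]≤f[argmax] {f = I} d a) (latest<R eq (res∈-split eqc))
  ...   | c₁ , c₂ , eq-cd , cut⇔ with witness c₁ c₂ eq-cd
  ...     | x , e , E , res-e∈ , no-deq-in-cut
    with null-drained D E (completed-before-latest eq d∈ (∈-cut⇒∈ {c₁ = c₁} {c₂} eqc eq-cd res-e∈)
                                                        (Equivalence.to cut⇔ res-e∈))
  ...       | d' , D' , d'⊏d =
    no-deq-in-cut (d' , D' , Equivalence.from cut⇔ (All.lookup (f[xs]≤f[argmax] {f = I} d a) (before⇒∈ eq d'⊏d)))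

  no-violation : ¬ HasViolation c
  no-violation (inj₁ v) = no-fresh v
  no-violation (inj₂ (inj₁ v)) = no-repet v
  no-violation (inj₂ (inj₂ (inj₁ v))) = no-ord v
  no-violation (inj₂ (inj₂ (inj₂ v))) = no-wit v

-- Greedy linearization

module Greedy (E : List Event) (I R : Event → ℕ) where

  infix 4 _≺_
  _≺_ : Event → Event → Set
  e ≺ e' = R e < I e'

  DeqBefore : List Event → ℕ → ℕ → Set
  DeqBefore evs x t = ∃[ d ] (d ∈ evs × IsDeq d x × I d < t)

  DeqBefore-delete : ∀ {x y evs t} → ¬ IsDeq x y → DeqBefore evs y t → DeqBefore (delete x evs) y t
  DeqBefore-delete not-x (d , d∈ , isD , lt) = d , ∈-delete⁺ d∈ (λ { refl → not-x isD }) , isD , lt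

  record Linearization (evs s : List Event) : Set where
    field
      unique : Unique s
      members : ∀ {e} → e ∈ s ⇔ e ∈ evs
      respects : ∀ {e e'} → e ∈ evs → e' ∈ evs → e ≺ e' → e ⊏[ s ] e'

  Minimal : List Event → Event → Set
  Minimal evs x = ∀ {e} → e ∈ evs → ¬ e ≺ x

  []-linearization : Linearization [] []
  []-linearization = record { unique = [] ; members = mk⇔ (λ ()) (λ ()) ; respects = λ () }

  ∷-linearization : ∀ {evs x s} → x ∈ evs → Minimal evs x → Linearization (delete x evs) s → Linearization evs (x ∷ s)
  ∷-linearization {evs} {x} {s} x∈ x-min lin = record
    { unique = All.tabulate (λ e∈s x≡e → deleted≢ (Equivalence.to members e∈s) (sym x≡e)) ∷ unique
    ; members = mk⇔ to from
    ; respects = respects′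
    }
    where
    open Linearization lin
    open Deleting x evs
    to : ∀ {e} → e ∈ x ∷ s → e ∈ evs
    to (here refl) = x∈
    to (there e∈) = kept (Equivalence.to members e∈)
    from : ∀ {e} → e ∈ evs → e ∈ x ∷ s
    from {e} e∈ with e ≟ₑ x
    ... | yes refl = here refl
    ... | no e≢x = there (Equivalence.from members (∈-delete⁺ e∈ e≢x))
    respects′ : ∀ {e e'} → e ∈ evs → e' ∈ evs → e ≺ e' → e ⊏[ x ∷ s ] e'
    respects′ {e} {e'} e∈ e'∈ e≺e' with e ≟ₑ x | e' ≟ₑ x
    ... | yes refl | yes refl = ⊥-elim (x-min x∈ e≺e')
    ... | yes refl | no e'≢x = [] , s , refl , Equivalence.from members (∈-delete⁺ e'∈ e'≢x)
    ... | no _ | yes refl = ⊥-elim (x-min e∈ e≺e')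
    ... | no e≢x | no e'≢x = ⊏-++ʳ (x ∷ []) (respects (∈-delete⁺ e∈ e≢x) (∈-delete⁺ e'∈ e'≢x) e≺e')

  FirstResponse : List Event → Event → Set
  FirstResponse evs f = ∀ {e} → e ∈ evs → R f ≤ R e

  early⇒minimal : ∀ {evs f x} → FirstResponse evs f → I x ≤ R f → Minimal evs x
  early⇒minimal f-first Ix≤Rf e∈ e≺x = <-irrefl refl (<-≤-trans e≺x (≤-trans Ix≤Rf (f-first e∈)))

  Candidate : List Event → Event → Set
  Candidate evs d = ∃[ x ] (IsDeq d x × HasEnq evs x)

  Candidate? : ∀ evs d → Dec (Candidate evs d)
  Candidate? evs (mkEv _ (deq (just x))) = map′ (λ h → x , isDeq , h) (λ { (_ , isDeq , h) → h }) (HasEnq? evs x)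
  Candidate? evs (mkEv _ (deq nothing)) = no λ { (_ , () , _) }
  Candidate? evs (mkEv _ (enq _)) = no λ { (_ , () , _) }

  EarlyCandidate : List Event → Event → Event → Set
  EarlyCandidate evs df d = Candidate evs d × (d ≡ df ⊎ d ≺ df)

  EarlyCandidate? : ∀ evs df d → Dec (EarlyCandidate evs df d)
  EarlyCandidate? evs df d = Candidate? evs d ×-dec (d ≟ₑ df ⊎-dec R d <? I df)

  first-response : ∀ {e} evs → e ∈ evs → ∃[ f ] (f ∈ evs × FirstResponse evs f)
  first-response evs e∈ with minimalBy {P = λ _ → ⊤} (λ _ → yes tt) R evs e∈ tt
  ... | f , f∈ , _ , f-first = f , f∈ , λ e∈ → f-first e∈ tt

  -- T n is a time inside the window of the null dequeue n by which every completed enqueue has had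
  -- its dequeue invoked, so that the queue may be empty there.
  module WithNullTimes (T : Event → ℕ) where

    record Consistent : Set where
      field
        I<R : ∀ {e} → e ∈ E → I e < R e
        enq-unique : ∀ {e e' x} → e ∈ E → e' ∈ E → IsEnq e x → IsEnq e' x → e ≡ e'
        deq-unique : ∀ {d d' x} → d ∈ E → d' ∈ E → IsDeq d x → IsDeq d' x → d ≡ d'
        deq-not-before-enq : ∀ {e d x} → e ∈ E → d ∈ E → IsEnq e x → IsDeq d x → ¬ d ≺ e
        fifo : ∀ {ey ex dy dx y x} → ey ∈ E → ex ∈ E → dy ∈ E → dx ∈ E →
               IsEnq ey y → IsEnq ex x → IsDeq dy y → IsDeq dx x → ey ≺ ex → ¬ dx ≺ dy
        null-window : ∀ {n} → n ∈ E → IsNullDeq n → I n ≤ T n × T n ≤ R n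

    -- evs are the events still to be linearized, starting from queue content q; the fields restate
    -- the absence of violations relative to q.
    record Invariant (evs : List Event) (q : List ℕ) : Set where
      field
        pending⊆ : ∀ {e} → e ∈ evs → e ∈ E
        deq-source : ∀ {d x} → d ∈ evs → IsDeq d x → x ∈ q ⊎ HasEnq evs x
        fifo-pending : ∀ {ey ex dx y x} → ey ∈ evs → ex ∈ evs → dx ∈ evs →
                       IsEnq ey y → IsEnq ex x → IsDeq dx x → ey ≺ ex → HasDeq evs y
        queued-first : ∀ {y dy ex dx x} → y ∈ q → dy ∈ evs → ex ∈ evs → dx ∈ evs →
                       IsDeq dy y → IsEnq ex x → IsDeq dx x → ¬ dx ≺ dy
        queued-first-pending : ∀ {y ex dx x} → y ∈ q → ex ∈ evs → dx ∈ evs →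
                               IsEnq ex x → IsDeq dx x → HasDeq evs y
        queue-fifo : ∀ {y x dy dx} → y ⊏[ q ] x → dy ∈ evs → dx ∈ evs → IsDeq dy y → IsDeq dx x → ¬ dx ≺ dy
        queue-fifo-pending : ∀ {y x} → y ⊏[ q ] x → HasDeq evs x → HasDeq evs y
        queued-not-pending : ∀ {e x} → x ∈ q → e ∈ evs → ¬ IsEnq e x
        queue-unique : Unique q
        null-enq : ∀ {n e x} → n ∈ evs → IsNullDeq n → e ∈ evs → IsEnq e x → R e < T n → DeqBefore evs x (T n)
        null-queued : ∀ {n x} → n ∈ evs → IsNullDeq n → x ∈ q → DeqBefore evs x (T n)

    empty-queue-invariant : ∀ {evs} → (∀ {e} → e ∈ evs → e ∈ E) →
      (∀ {d x} → d ∈ evs → IsDeq d x → HasEnq evs x) →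
      (∀ {ey ex dx y x} → ey ∈ evs → ex ∈ evs → dx ∈ evs →
         IsEnq ey y → IsEnq ex x → IsDeq dx x → ey ≺ ex → HasDeq evs y) →
      (∀ {n e x} → n ∈ evs → IsNullDeq n → e ∈ evs → IsEnq e x → R e < T n → DeqBefore evs x (T n)) →
      Invariant evs []
    empty-queue-invariant pending⊆ deq-source fifo-pending null-enq = record
      { pending⊆ = pending⊆
      ; deq-source = λ d∈ isD → inj₂ (deq-source d∈ isD)
      ; fifo-pending = fifo-pending
      ; queued-first = λ ()
      ; queued-first-pending = λ ()
      ; queue-fifo = λ y⊏x → ⊥-elim (⊏-[] y⊏x)
      ; queue-fifo-pending = λ y⊏x → ⊥-elim (⊏-[] y⊏x)
      ; queued-not-pending = λ ()
      ; queue-unique = []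
      ; null-enq = null-enq
      ; null-queued = λ _ _ ()
      }

    record Step (evs : List Event) (q : List ℕ) : Set where
      field
        next : Event
        next∈ : next ∈ evs
        next-minimal : Minimal evs next
        queue′ : List ℕ
        run : ∀ {s} → Run queue′ s → Run q (next ∷ s)
        invariant : Invariant (delete next evs) queue′

    NullsLate : List Event → Event → Set
    NullsLate evs f = ∀ {n} → n ∈ evs → IsNullDeq n → R f < T n

    module _ (consistent : Consistent) where

      open Consistent consistent

      delete-null : ∀ {evs n} → Invariant evs [] → IsNullDeq n → Invariant (delete n evs) []
      delete-null {evs} {n} iv isN = empty-queue-invariant
        (λ e∈ → pending⊆ (kept e∈))
        (λ d∈ isD → [ (λ ()) , HasEnq-delete (null-not-enq isN) ] (deq-source (kept d∈) isD))
        (λ ey∈ ex∈ dx∈ isEy isEx isDx lt →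
           HasDeq-delete (null-not-deq isN) (fifo-pending (kept ey∈) (kept ex∈) (kept dx∈) isEy isEx isDx lt))
        (λ n∈ isN' e∈ isE lt → DeqBefore-delete (null-not-deq isN) (null-enq (kept n∈) isN' (kept e∈) isE lt))
        where
        open Invariant iv
        open Deleting n evs

      delete-deq : ∀ {evs x q d} → Invariant evs (x ∷ q) → d ∈ evs → IsDeq d x → Invariant (delete d evs) q
      delete-deq {evs} {x} {q} {d} iv d∈ isD = record
        { pending⊆ = λ e∈ → pending⊆ (kept e∈)
        ; deq-source = deq-source′
        ; fifo-pending = λ ey∈ ex∈ dx∈ isEy isEx isDx lt →
            HasDeq-delete (not-pending (kept ey∈) isEy) (fifo-pending (kept ey∈) (kept ex∈) (kept dx∈) isEy isEx isDx lt)
        ; queued-first = λ y∈ dy∈ ex∈ dx∈ → queued-first (there y∈) (kept dy∈) (kept ex∈) (kept dx∈)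
        ; queued-first-pending = λ y∈ ex∈ dx∈ isEx isDx →
            HasDeq-delete (not-queued y∈) (queued-first-pending (there y∈) (kept ex∈) (kept dx∈) isEx isDx)
        ; queue-fifo = λ y⊏x dy∈ dx∈ → queue-fifo (⊏-++ʳ (x ∷ []) y⊏x) (kept dy∈) (kept dx∈)
        ; queue-fifo-pending = λ y⊏x (dx , dx∈ , isDx) →
            HasDeq-delete (not-queued (⊏⇒∈ˡ y⊏x)) (queue-fifo-pending (⊏-++ʳ (x ∷ []) y⊏x) (dx , kept dx∈ , isDx))
        ; queued-not-pending = λ y∈ e∈ → queued-not-pending (there y∈) (kept e∈)
        ; queue-unique = tail queue-unique
        ; null-enq = λ n∈ isN e∈ isE lt →
            DeqBefore-delete (not-pending (kept e∈) isE) (null-enq (kept n∈) isN (kept e∈) isE lt)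
        ; null-queued = λ n∈ isN y∈ → DeqBefore-delete (not-queued y∈) (null-queued (kept n∈) isN (there y∈))
        }
        where
        open Invariant iv
        open Deleting d evs
        tail : ∀ {x} {q : List ℕ} → Unique (x ∷ q) → Unique q
        tail (_ ∷ u) = u
        not-pending : ∀ {e y} → e ∈ evs → IsEnq e y → ¬ IsDeq d y
        not-pending e∈ isE isD' with IsDeq-functional isD isD'
        ... | refl = queued-not-pending (here refl) e∈ isE
        not-queued : ∀ {y} → y ∈ q → ¬ IsDeq d y
        not-queued y∈ isD' with IsDeq-functional isD isD'
        ... | refl = Unique[x∷xs]⇒x∉xs queue-unique y∈
        deq-source′ : ∀ {d' y} → d' ∈ delete d evs → IsDeq d' y → y ∈ q ⊎ HasEnq (delete d evs) y
        deq-source′ d'∈ isD' with deq-source (kept d'∈) isD'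
        ... | inj₁ (here refl) = ⊥-elim (deleted≢ d'∈ (deq-unique (pending⊆ (kept d'∈)) (pending⊆ d∈) isD' isD))
        ... | inj₁ (there y∈q) = inj₁ y∈q
        ... | inj₂ has-enq = inj₂ (HasEnq-delete (deq-not-enq isD) has-enq)

      delete-enq : ∀ {evs q e w} → Invariant evs q → e ∈ evs → IsEnq e w →
        (∀ {dy ex dx x} → dy ∈ evs → ex ∈ evs → dx ∈ evs →
           IsDeq dy w → IsEnq ex x → IsDeq dx x → ¬ dx ≺ dy) →
        (∀ {ex dx x} → ex ∈ evs → dx ∈ evs → IsEnq ex x → IsDeq dx x → HasDeq evs w) →
        (∀ {n} → n ∈ evs → IsNullDeq n → DeqBefore evs w (T n)) →
        Invariant (delete e evs) (q ++ w ∷ [])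
      delete-enq {evs} {q} {e} {w} iv e∈ isE w-first w-first-pending w-null = record
        { pending⊆ = λ e∈ → pending⊆ (kept e∈)
        ; deq-source = deq-source′
        ; fifo-pending = λ ey∈ ex∈ dx∈ isEy isEx isDx lt →
            keepDeq (fifo-pending (kept ey∈) (kept ex∈) (kept dx∈) isEy isEx isDx lt)
        ; queued-first = queued-first′
        ; queued-first-pending = queued-first-pending′
        ; queue-fifo = queue-fifo′
        ; queue-fifo-pending = queue-fifo-pending′
        ; queued-not-pending = queued-not-pending′
        ; queue-unique = ++⁺ queue-unique (All.[] ∷ [])
                             (λ { (w∈q , here refl) → queued-not-pending w∈q e∈ isE })
        ; null-enq = λ n∈ isN e'∈ isE' lt →
            DeqBefore-delete (enq-not-deq isE) (null-enq (kept n∈) isN (kept e'∈) isE' lt)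
        ; null-queued = null-queued′
        }
        where
        open Invariant iv
        open Deleting e evs
        keepDeq : ∀ {y} → HasDeq evs y → HasDeq (delete e evs) y
        keepDeq = HasDeq-delete (enq-not-deq isE)
        deq-source′ : ∀ {d y} → d ∈ delete e evs → IsDeq d y → y ∈ q ++ w ∷ [] ⊎ HasEnq (delete e evs) y
        deq-source′ d∈ isD with deq-source (kept d∈) isD
        ... | inj₁ y∈q = inj₁ (∈-++⁺ˡ y∈q)
        ... | inj₂ (e' , e'∈ , isE') with e' ≟ₑ e
        ...   | yes refl = inj₁ (∈-++⁺ʳ q (here (IsEnq-functional isE' isE)))
        ...   | no e'≢e = inj₂ (e' , ∈-delete⁺ e'∈ e'≢e , isE')
        queued-first′ : ∀ {y dy ex dx x} → y ∈ q ++ w ∷ [] →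
                        dy ∈ delete e evs → ex ∈ delete e evs → dx ∈ delete e evs →
                        IsDeq dy y → IsEnq ex x → IsDeq dx x → ¬ dx ≺ dy
        queued-first′ y∈ dy∈ ex∈ dx∈ with ∈-++⁻ q y∈
        ... | inj₁ y∈q = queued-first y∈q (kept dy∈) (kept ex∈) (kept dx∈)
        ... | inj₂ (here refl) = w-first (kept dy∈) (kept ex∈) (kept dx∈)
        queued-first-pending′ : ∀ {y ex dx x} → y ∈ q ++ w ∷ [] → ex ∈ delete e evs → dx ∈ delete e evs →
                                IsEnq ex x → IsDeq dx x → HasDeq (delete e evs) y
        queued-first-pending′ y∈ ex∈ dx∈ isEx isDx with ∈-++⁻ q y∈
        ... | inj₁ y∈q = keepDeq (queued-first-pending y∈q (kept ex∈) (kept dx∈) isEx isDx)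
        ... | inj₂ (here refl) = keepDeq (w-first-pending (kept ex∈) (kept dx∈) isEx isDx)
        queue-fifo′ : ∀ {y x dy dx} → y ⊏[ q ++ w ∷ [] ] x → dy ∈ delete e evs → dx ∈ delete e evs →
                      IsDeq dy y → IsDeq dx x → ¬ dx ≺ dy
        queue-fifo′ y⊏x dy∈ dx∈ isDy isDx with ⊏-snoc q y⊏x
        ... | inj₁ y⊏x′ = queue-fifo y⊏x′ (kept dy∈) (kept dx∈) isDy isDx
        ... | inj₂ (y∈q , refl) = queued-first y∈q (kept dy∈) e∈ (kept dx∈) isDy isE isDx
        queue-fifo-pending′ : ∀ {y x} → y ⊏[ q ++ w ∷ [] ] x → HasDeq (delete e evs) x → HasDeq (delete e evs) y
        queue-fifo-pending′ y⊏x (dx , dx∈ , isDx) with ⊏-snoc q y⊏x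
        ... | inj₁ y⊏x′ = keepDeq (queue-fifo-pending y⊏x′ (dx , kept dx∈ , isDx))
        ... | inj₂ (y∈q , refl) = keepDeq (queued-first-pending y∈q e∈ (kept dx∈) isE isDx)
        queued-not-pending′ : ∀ {e' x} → x ∈ q ++ w ∷ [] → e' ∈ delete e evs → ¬ IsEnq e' x
        queued-not-pending′ x∈ e'∈ isE' with ∈-++⁻ q x∈
        ... | inj₁ x∈q = queued-not-pending x∈q (kept e'∈) isE'
        ... | inj₂ (here refl) = deleted≢ e'∈ (enq-unique (pending⊆ (kept e'∈)) (pending⊆ e∈) isE' isE)
        null-queued′ : ∀ {n x} → n ∈ delete e evs → IsNullDeq n → x ∈ q ++ w ∷ [] → DeqBefore (delete e evs) x (T n)
        null-queued′ n∈ isN x∈ with ∈-++⁻ q x∈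
        ... | inj₁ x∈q = DeqBefore-delete (enq-not-deq isE) (null-queued (kept n∈) isN x∈q)
        ... | inj₂ (here refl) = DeqBefore-delete (enq-not-deq isE) (w-null (kept n∈) isN)

      step-candidate : ∀ {evs q dw ew w} → Invariant evs q → dw ∈ evs → IsDeq dw w → ew ∈ evs → IsEnq ew w →
        Minimal evs ew → (∀ {dx} → dx ∈ evs → Candidate evs dx → ¬ dx ≺ dw) →
        (∀ {n} → n ∈ evs → IsNullDeq n → DeqBefore evs w (T n)) → Step evs q
      step-candidate {evs} {w = w} iv dw∈ isDw ew∈ isEw ew-min none-before w-null = record
        { next∈ = ew∈ ; next-minimal = ew-min ; run = Run-enq isEw
        ; invariant = delete-enq iv ew∈ isEw w-first (λ _ _ _ _ → _ , dw∈ , isDw) w-null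
        }
        where
        open Invariant iv
        w-first : ∀ {dy ex dx x} → dy ∈ evs → ex ∈ evs → dx ∈ evs →
                  IsDeq dy w → IsEnq ex x → IsDeq dx x → ¬ dx ≺ dy
        w-first dy∈ ex∈ dx∈ isDy isEx isDx with deq-unique (pending⊆ dy∈) (pending⊆ dw∈) isDy isDw
        ... | refl = none-before dx∈ (_ , isDx , _ , ex∈ , isEx)

      step-lone-enq : ∀ {evs q f v} → Invariant evs q → f ∈ evs → FirstResponse evs f → IsEnq f v →
        NullsLate evs f → (∀ {d} → d ∈ evs → ¬ Candidate evs d) → Step evs q
      step-lone-enq {evs} {v = v} iv f∈ f-first isF nulls-late no-candidate = record
        { next∈ = f∈ ; next-minimal = early⇒minimal f-first (<⇒≤ (I<R (pending⊆ f∈))) ; run = Run-enq isF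
        ; invariant = delete-enq iv f∈ isF (λ _ ex∈ dx∈ _ isEx isDx → ⊥-elim (no-candidate dx∈ (_ , isDx , _ , ex∈ , isEx)))
                                         (λ ex∈ dx∈ isEx isDx → ⊥-elim (no-candidate dx∈ (_ , isDx , _ , ex∈ , isEx)))
                                         f-dequeued
        }
        where
        open Invariant iv
        f-dequeued : ∀ {n} → n ∈ evs → IsNullDeq n → DeqBefore evs v (T n)
        f-dequeued n∈ isN with null-enq n∈ isN f∈ isF (nulls-late n∈ isN)
        ... | d , d∈ , isD , _ = ⊥-elim (no-candidate d∈ (_ , isD , _ , f∈ , isF))

      step-before-deq-of-first : ∀ {evs q f v df} → Invariant evs q → f ∈ evs → FirstResponse evs f → IsEnq f v →
        NullsLate evs f → df ∈ evs → IsDeq df v → Step evs q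
      step-before-deq-of-first {evs} {f = f} {v} {df} iv f∈ f-first isF nulls-late df∈ isDf
        with minimalBy (EarlyCandidate? evs df) R evs df∈ ((v , isDf , f , f∈ , isF) , inj₁ refl)
      ... | dw , dw∈ , ((w , isDw , ew , ew∈ , isEw) , dw-early) , dw-min =
        step-candidate iv dw∈ isDw ew∈ isEw ew-min none-before w-null
        where
        open Invariant iv
        ≺dw⇒≺df : ∀ {dx} → dx ≺ dw → dx ≺ df
        ≺dw⇒≺df dx≺dw =
          [ (λ { refl → dx≺dw }) , (λ dw≺df → <-trans dx≺dw (<-trans (I<R (pending⊆ dw∈)) dw≺df)) ] dw-early
        none-before : ∀ {dx} → dx ∈ evs → Candidate evs dx → ¬ dx ≺ dw
        none-before dx∈ cand dx≺dw =
          <-irrefl refl (<-≤-trans (<-trans dx≺dw (I<R (pending⊆ dw∈))) (dw-min dx∈ (cand , inj₂ (≺dw⇒≺df dx≺dw))))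
        w-null : ∀ {n} → n ∈ evs → IsNullDeq n → DeqBefore evs w (T n)
        w-null n∈ isN with null-enq n∈ isN f∈ isF (nulls-late n∈ isN)
        ... | d , d∈ , isD , Id<Tn with deq-unique (pending⊆ d∈) (pending⊆ df∈) isD isDf
        ...   | refl = dw , dw∈ , isDw ,
          [ (λ { refl → Id<Tn }) , (λ dw≺d → <-trans (<-trans (I<R (pending⊆ dw∈)) dw≺d) Id<Tn) ] dw-early
        ew-min : Minimal evs ew
        ew-min e∈ e≺ew = not-before dw-early (≤-<-trans (f-first e∈) e≺ew)
          where
          not-before : dw ≡ df ⊎ dw ≺ df → ¬ f ≺ ew
          not-before (inj₁ refl) f≺ew
            with enq-unique (pending⊆ ew∈) (pending⊆ f∈) isEw (subst (IsEnq f) (IsDeq-functional isDf isDw) isF)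
          ... | refl = <-asym f≺ew (I<R (pending⊆ f∈))
          not-before (inj₂ dw≺df) f≺ew =
            fifo (pending⊆ f∈) (pending⊆ ew∈) (pending⊆ df∈) (pending⊆ dw∈) isF isEw isDf isDw f≺ew dw≺df

      step-earliest-candidate : ∀ {evs q f v d₀} → Invariant evs q → f ∈ evs → FirstResponse evs f → IsEnq f v →
        NullsLate evs f → ¬ HasDeq evs v → d₀ ∈ evs → Candidate evs d₀ → Step evs q
      step-earliest-candidate {evs} iv f∈ f-first isF nulls-late no-deq d₀∈ cand₀
        with minimalBy (Candidate? evs) R evs d₀∈ cand₀
      ... | dw , dw∈ , (w , isDw , ew , ew∈ , isEw) , dw-min =
        step-candidate iv dw∈ isDw ew∈ isEw ew-min none-before w-null
        where
        open Invariant iv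
        none-before : ∀ {dx} → dx ∈ evs → Candidate evs dx → ¬ dx ≺ dw
        none-before dx∈ cand dx≺dw = <-irrefl refl (<-≤-trans (<-trans dx≺dw (I<R (pending⊆ dw∈))) (dw-min dx∈ cand))
        w-null : ∀ {n} → n ∈ evs → IsNullDeq n → DeqBefore evs w (T n)
        w-null n∈ isN with null-enq n∈ isN f∈ isF (nulls-late n∈ isN)
        ... | d , d∈ , isD , _ = ⊥-elim (no-deq (d , d∈ , isD))
        ew-min : Minimal evs ew
        ew-min e∈ e≺ew = no-deq (fifo-pending f∈ ew∈ dw∈ isF isEw isDw (≤-<-trans (f-first e∈) e≺ew))

      -- Linearize next the enqueue of the candidate dequeue responding first (among those not after the
      -- dequeue of f's value, if any), so that dequeues stay in FIFO order; without candidates, f itself.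
      step-enq : ∀ {evs q f v} → Invariant evs q → f ∈ evs → FirstResponse evs f → IsEnq f v →
                 NullsLate evs f → Step evs q
      step-enq {evs} {v = v} iv f∈ f-first isF nulls-late with HasDeq? evs v
      ... | yes (df , df∈ , isDf) = step-before-deq-of-first iv f∈ f-first isF nulls-late df∈ isDf
      ... | no no-deq with ∃∈? (Candidate? evs) evs
      ...   | yes (d₀ , d₀∈ , cand₀) = step-earliest-candidate iv f∈ f-first isF nulls-late no-deq d₀∈ cand₀
      ...   | no no-candidate = step-lone-enq iv f∈ f-first isF nulls-late (λ d∈ cand → no-candidate (_ , d∈ , cand))

      first-is-enq : ∀ {evs x q f} → Invariant evs (x ∷ q) → f ∈ evs →
                     (∀ {d} → d ∈ evs → IsDeq d x → f ≺ d) → ∃[ v ] IsEnq f v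
      first-is-enq {f = mkEv _ (enq v)} iv f∈ late = v , isEnq
      first-is-enq {f = mkEv _ (deq nothing)} iv f∈ late with Invariant.null-queued iv f∈ isNullDeq (here refl)
      ... | d , d∈ , isD , Id<Tf =
        ⊥-elim (<-asym (late d∈ isD) (<-≤-trans Id<Tf (proj₂ (null-window (Invariant.pending⊆ iv f∈) isNullDeq))))
      first-is-enq {q = q} {f = mkEv _ (deq (just y))} iv f∈ late with Invariant.deq-source iv f∈ isDeq
      ... | inj₁ (here refl) = ⊥-elim (<-asym (late f∈ isDeq) (I<R (Invariant.pending⊆ iv f∈)))
      ... | inj₁ (there y∈q) with Invariant.queue-fifo-pending iv ([] , q , refl , y∈q) (_ , f∈ , isDeq)
      ...   | dx , dx∈ , isDx = ⊥-elim (Invariant.queue-fifo iv ([] , q , refl , y∈q) dx∈ f∈ isDx isDeq (late dx∈ isDx))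
      first-is-enq {f = mkEv _ (deq (just y))} iv f∈ late | inj₂ (ey , ey∈ , isEy)
        with Invariant.queued-first-pending iv (here refl) ey∈ f∈ isEy isDeq
      ... | dx , dx∈ , isDx = ⊥-elim (Invariant.queued-first iv (here refl) dx∈ ey∈ f∈ isDx isEy isDeq (late dx∈ isDx))

      step-empty-queue : ∀ {evs f} → Invariant evs [] → f ∈ evs → FirstResponse evs f → NullsLate evs f →
                         ¬ IsNullDeq f → Step evs []
      step-empty-queue {f = mkEv _ (enq _)} iv f∈ f-first nulls-late _ = step-enq iv f∈ f-first isEnq nulls-late
      step-empty-queue {f = mkEv _ (deq nothing)} _ _ _ _ not-null = ⊥-elim (not-null isNullDeq)
      step-empty-queue {evs} {f@(mkEv _ (deq (just _)))} iv f∈ f-first nulls-late _ with Invariant.deq-source iv f∈ isDeq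
      ... | inj₂ (e , e∈ , isE) = step-candidate iv f∈ isDeq e∈ isE e-min f-first-deq
          (λ n∈ isN → f , f∈ , isDeq , <-trans (I<R (pending⊆ f∈)) (nulls-late n∈ isN))
        where
        open Invariant iv
        e-min : Minimal evs e
        e-min e'∈ e'≺e = deq-not-before-enq (pending⊆ e∈) (pending⊆ f∈) isE isDeq (≤-<-trans (f-first e'∈) e'≺e)
        f-first-deq : ∀ {dx} → dx ∈ evs → Candidate evs dx → ¬ dx ≺ f
        f-first-deq dx∈ _ dx≺f = <-irrefl refl (<-≤-trans (<-trans dx≺f (I<R (pending⊆ f∈))) (f-first dx∈))

      step : ∀ {evs q f} → Invariant evs q → f ∈ evs → FirstResponse evs f → Step evs q
      step {evs} {[]} {f} iv f∈ f-first with ∃∈? (λ n → IsNullDeq? n ×-dec I n ≤? R f) evs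
      ... | yes (n , n∈ , isN , early) = record
        { next∈ = n∈ ; next-minimal = early⇒minimal f-first early ; run = Run-null isN ; invariant = delete-null iv isN }
      ... | no no-early-null = step-empty-queue iv f∈ f-first nulls-late
                                 (λ isN → no-early-null (f , f∈ , isN , <⇒≤ (I<R (Invariant.pending⊆ iv f∈))))
        where
        nulls-late : NullsLate evs f
        nulls-late n∈ isN = <-≤-trans (≰⇒> (λ In≤Rf → no-early-null (_ , n∈ , isN , In≤Rf)))
                                      (proj₁ (null-window (Invariant.pending⊆ iv n∈) isN))
      step {evs} {x ∷ q} {f} iv f∈ f-first with ∃∈? (λ d → IsDeq? d x ×-dec I d ≤? R f) evs
      ... | yes (d , d∈ , isD , early) = record
        { next∈ = d∈ ; next-minimal = early⇒minimal f-first early ; run = Run-deq isD ; invariant = delete-deq iv d∈ isD }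
      ... | no no-early-deq = step-enq iv f∈ f-first (proj₂ (first-is-enq iv f∈ late)) nulls-late
        where
        late : ∀ {d} → d ∈ evs → IsDeq d x → f ≺ d
        late d∈ isD = ≰⇒> (λ Id≤Rf → no-early-deq (_ , d∈ , isD , Id≤Rf))
        nulls-late : NullsLate evs f
        nulls-late n∈ isN with Invariant.null-queued iv n∈ isN (here refl)
        ... | d , d∈ , isD , Id<Tn = <-trans (late d∈ isD) Id<Tn

      linearize-within : ∀ n {evs q} → length evs ≤ n → Invariant evs q → ∃[ s ] (Linearization evs s × Run q s)
      linearize-within _ {[]} _ _ = [] , []-linearization , done
      linearize-within zero {_ ∷ _} () _
      linearize-within (suc n) {evs@(_ ∷ _)} len iv with first-response evs (here refl)
      ... | f , f∈ , f-first with step iv f∈ f-first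
      ...   | record { next∈ = next∈ ; next-minimal = next-minimal ; run = run ; invariant = iv′ }
        with linearize-within n (s≤s⁻¹ (≤-trans (length-delete evs next∈) len)) iv′
      ...     | s , lin , run′ = _ ∷ s , ∷-linearization next∈ next-minimal lin , run run′

      linearize : Invariant E [] → ∃[ s ] (Linearization E s × Run [] s)
      linearize = linearize-within (length E) ≤-refl

-- A violation-free history is linearizable

module NoViolation⇒Linearizable (c : History) (wf : WellFormed c) (cp : Complete c) (eu : EnqUnique c)
  (no-violation : ¬ HasViolation c) where

  open Times c wf

  E : List Event
  E = events c

  inv∈ : ∀ {e} → e ∈ E → inv e ∈ c
  inv∈ = Equivalence.to (∈-events⇔ c)

  res∈ : ∀ {e} → e ∈ E → res e ∈ c
  res∈ e∈ = cp _ (inv∈ e∈)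

  ∈E : ∀ {e} → inv e ∈ c → e ∈ E
  ∈E = Equivalence.from (∈-events⇔ c)

  open Greedy E I R

  DeqBefore? : ∀ x t → Dec (DeqBefore E x t)
  DeqBefore? x t = ∃∈? (λ d → IsDeq? d x ×-dec I d <? t) E

  Undrained : ℕ → Event → Set
  Undrained t e = ∃[ x ] (IsEnq e x × R e < t × ¬ DeqBefore E x t)

  Undrained? : ∀ t e → Dec (Undrained t e)
  Undrained? t e@(mkEv _ (enq x)) =
    map′ (λ (lt , none) → x , isEnq , lt , none) (λ { (_ , isEnq , lt , none) → lt , none })
         (R e <? t ×-dec ¬? (DeqBefore? x t))
  Undrained? t (mkEv _ (deq _)) = no λ { (_ , () , _) }

  Drained : ℕ → Set
  Drained t = ¬ (∃[ e ] (e ∈ E × Undrained t e))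

  Drained? : ∀ t → Dec (Drained t)
  Drained? t = ¬? (∃∈? (Undrained? t) E)

  Drained⇒DeqBefore : ∀ {t e x} → Drained t → e ∈ E → IsEnq e x → R e < t → DeqBefore E x t
  Drained⇒DeqBefore {t} {e} {x} drained e∈ isE lt =
    decidable-stable (DeqBefore? x t) (λ none → drained (e , e∈ , x , isE , lt , none))

  GoodTime : Event → Set
  GoodTime n = ∃[ t ] (t < suc (R n) × I n ≤ t × Drained t)

  search : ∀ n → Dec (GoodTime n)
  search n = anyUpTo? (λ t → I n ≤? t ×-dec Drained? t) (suc (R n))

  -- The fallback 0 is never used: null dequeues always have a good time (lemma good-time).
  time : ∀ {n} → Dec (GoodTime n) → ℕ
  time (yes (t , _)) = t
  time (no _) = 0

  T : Event → ℕ
  T n = time (search n)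

  good-time : ∀ {n} → n ∈ E → IsNullDeq n → GoodTime n
  good-time {n} n∈ isN with proj₁ (proj₂ wf) n (res∈ n∈)
  ... | p , c₃ , eq , inv∈p with ∈-∃++ inv∈p
  ...   | c₀ , cd , refl =
    decidable-stable (search n) λ no-good → no-violation (inj₂ (inj₂ (inj₂
      (n , c₀ , cd , c₃ , (inv∈ n∈ , IsNullDeq⇒null isN) , eqc , witness no-good))))
    where
    eqc : c ≡ c₀ ++ inv n ∷ cd ++ res n ∷ c₃
    eqc = trans eq (++-assoc c₀ (inv n ∷ cd) (res n ∷ c₃))
    witness : ¬ GoodTime n → ∀ c₁ c₂ → cd ≡ c₁ ++ c₂ →
      ∃[ x ] ∃[ e ] (IsEnqOf c e x × res e ∈ (c₀ ++ inv n ∷ c₁) ×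
        ¬ (∃[ d' ] (IsDeqOf c d' (just x) × inv d' ∈ (c₀ ++ inv n ∷ c₁))))
    witness no-good c₁ c₂ refl = conclude (decidable-stable (∃∈? (Undrained? t) E) not-drained)
      where
      t : ℕ
      t = I n + suc (length c₁)
      t<1+Rn : t < suc (R n)
      t<1+Rn = s≤s (subst (t ≤_) (sym Rn≡) (+-monoʳ-≤ (I n) (s≤s |c₁|≤)))
        where
        Rn≡ : R n ≡ I n + suc (length (c₁ ++ c₂))
        Rn≡ = trans (proj₂ (times-of-split eqc)) (cong (_+ _) (sym (proj₁ (times-of-split eqc))))
        |c₁|≤ : length c₁ ≤ length (c₁ ++ c₂)
        |c₁|≤ = subst (length c₁ ≤_) (sym (length-++ c₁)) (m≤m+n _ _)
      not-drained : ¬ Drained t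
      not-drained drained = no-good (t , t<1+Rn , m≤m+n (I n) _ , drained)
      cut⇔ : ∀ {α} → α ∈ c₀ ++ inv n ∷ c₁ ⇔ Act.position α c < t
      cut⇔ = ∈-cut⇔ {c₁ = c₁} {c₂} eqc refl
      conclude : ∃[ e ] (e ∈ E × Undrained t e) →
        ∃[ x ] ∃[ e ] (IsEnqOf c e x × res e ∈ (c₀ ++ inv n ∷ c₁) ×
          ¬ (∃[ d' ] (IsDeqOf c d' (just x) × inv d' ∈ (c₀ ++ inv n ∷ c₁))))
      conclude (e , e∈ , x , isE , Re<t , no-deq) =
        x , e , (inv∈ e∈ , IsEnq⇒enq isE) , Equivalence.from cut⇔ Re<t ,
        λ (d' , (d'∈c , opd') , inv-d'∈) → no-deq (d' , ∈E d'∈c , deq⇒IsDeq opd' , Equivalence.to cut⇔ inv-d'∈)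

  time-spec : ∀ {n} → n ∈ E → IsNullDeq n → I n ≤ T n × T n ≤ R n × Drained (T n)
  time-spec {n} n∈ isN = spec (search n) (good-time n∈ isN)
    where
    spec : (r : Dec (GoodTime n)) → GoodTime n → I n ≤ time r × time r ≤ R n × Drained (time r)
    spec (yes (t , t<1+Rn , In≤t , drained)) _ = In≤t , s≤s⁻¹ t<1+Rn , drained
    spec (no no-good) good = ⊥-elim (no-good good)

  open WithNullTimes T

  ≺⇒≺c : ∀ {e e'} → e ∈ E → e' ∈ E → e ≺ e' → e ≺[ c ] e'
  ≺⇒≺c e∈ e'∈ = <⇒≺ (res∈ e∈) (inv∈ e'∈)

  consistent : Consistent
  consistent = record
    { I<R = λ e∈ → I<R (res∈ e∈)
    ; enq-unique = λ e∈ e'∈ isE isE' → eu _ _ _ (inv∈ e∈ , IsEnq⇒enq isE) (inv∈ e'∈ , IsEnq⇒enq isE')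
    ; deq-unique = deq-unique
    ; deq-not-before-enq = λ e∈ d∈ isE isD d≺e → no-violation (inj₁
        (_ , _ , (inv∈ d∈ , IsDeq⇒deq isD) , inj₂ (_ , (inv∈ e∈ , IsEnq⇒enq isE) , ≺⇒≺c d∈ e∈ d≺e)))
    ; fifo = λ ey∈ ex∈ dy∈ dx∈ isEy isEx isDy isDx ey≺ex dx≺dy → no-violation (inj₂ (inj₂ (inj₁
        (_ , _ , _ , _ , _ , (inv∈ ex∈ , IsEnq⇒enq isEx) , (inv∈ ey∈ , IsEnq⇒enq isEy) , ≺⇒≺c ey∈ ex∈ ey≺ex ,
         (inv∈ dx∈ , IsDeq⇒deq isDx) , inj₂ (_ , (inv∈ dy∈ , IsDeq⇒deq isDy) , ≺⇒≺c dx∈ dy∈ dx≺dy)))))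
    ; null-window = λ n∈ isN → let (In≤Tn , Tn≤Rn , _) = time-spec n∈ isN in In≤Tn , Tn≤Rn
    }
    where
    deq-unique : ∀ {d d' x} → d ∈ E → d' ∈ E → IsDeq d x → IsDeq d' x → d ≡ d'
    deq-unique {d} {d'} d∈ d'∈ isD isD' with d ≟ₑ d'
    ... | yes d≡d' = d≡d'
    ... | no d≢d' = ⊥-elim (no-violation (inj₂ (inj₁
          (_ , d , d' , d≢d' , (inv∈ d∈ , IsDeq⇒deq isD) , (inv∈ d'∈ , IsDeq⇒deq isD')))))

  initial : Invariant E []
  initial = empty-queue-invariant (λ e∈ → e∈) deq-source fifo-pending
    (λ n∈ isN e∈ isE lt → Drained⇒DeqBefore (proj₂ (proj₂ (time-spec n∈ isN))) e∈ isE lt)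
    where
    deq-source : ∀ {d x} → d ∈ E → IsDeq d x → HasEnq E x
    deq-source {x = x} d∈ isD = decidable-stable (HasEnq? E x) λ no-enq → no-violation (inj₁
      (x , _ , (inv∈ d∈ , IsDeq⇒deq isD) , inj₁ λ (e , e∈c , ope) → no-enq (e , ∈E e∈c , enq⇒IsEnq ope)))
    fifo-pending : ∀ {ey ex dx y x} → ey ∈ E → ex ∈ E → dx ∈ E →
                   IsEnq ey y → IsEnq ex x → IsDeq dx x → ey ≺ ex → HasDeq E y
    fifo-pending {y = y} ey∈ ex∈ dx∈ isEy isEx isDx ey≺ex = decidable-stable (HasDeq? E y) λ no-deq → no-violation
      (inj₂ (inj₂ (inj₁ (_ , _ , _ , _ , _ , (inv∈ ex∈ , IsEnq⇒enq isEx) , (inv∈ ey∈ , IsEnq⇒enq isEy) , ≺⇒≺c ey∈ ex∈ ey≺ex ,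
        (inv∈ dx∈ , IsDeq⇒deq isDx) , inj₁ λ (dy , dy∈c , opdy) → no-deq (dy , ∈E dy∈c , deq⇒IsDeq opdy)))))

  linearizable : Linearizable c
  linearizable with linearize consistent initial
  ... | s , lin , run = s , (unique , λ e → members⇔) , run , respects′
    where
    open Linearization lin
    members⇔ : ∀ {e} → e ∈ s ⇔ EvOf c e
    members⇔ = mk⇔ (λ e∈s → inv∈ (Equivalence.to members e∈s)) (λ e∈c → Equivalence.from members (∈E e∈c))
    respects′ : ∀ e e' → e ≺[ c ] e' → Precedes s e e'
    respects′ e e' e≺e' = respects (∈E (res∈⇒inv∈ (⊏⇒∈ˡ e≺e'))) (∈E (⊏⇒∈ʳ e≺e')) (≺⇒< e≺e')

proposition4p8 : ∀ (c : History) → WellFormed c → Complete c → EnqUnique c →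
    (Linearizable c ⇔ (¬ HasViolation c))
proposition4p8 c wf cp eu = mk⇔
  (λ (s , (us , ∈s⇔) , legal , resp) → Linearizable⇒NoViolation.no-violation c wf eu us ∈s⇔ legal resp)
  (NoViolation⇒Linearizable.linearizable c wf cp eu)
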